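{- Let $P$ be the permutation matrix of a uniformly random permutation in $S_n$, and let $0\le x_1\le x_2\le n$, $0\le y_1\le y_2\le n$ be integers. For a set $S$ of positions write $P_S$ for the restriction of $P$ to $S$ and $|P_S|$ for the number of $1$'s in it. Let $m_1=|P_{[x_1]\times(y_1,y_2]}|$, $m_2=|P_{(x_1,x_2]\times[y_1]}|$, $m_3=|P_{(x_1,x_2]\times(y_1,y_2]}|$. Then conditionally on $P_{([x_2]\times[y_2])\setminus([x_1]\times[y_1])}$, the random variable $|P_{[x_1]\times[y_1]}|$ has distribution $$\operatorname{HyperGeom}\big(n-(x_2-x_1)-(y_2-y_1)+m_3,\ y_1-m_2,\ x_1-m_1\big).$$
   Context: $\operatorname{HyperGeom}(N,B,A)$ denotes the law of the number of red objects obtained when $B$ objects are drawn uniformly without replacement from $N$ objects of which $A$ are red and $N-A$ are blue. The permutation matrix of $\sigma$ has $P(i,j)=1$ iff $\sigma(i)=j$; $[m]=\{1,\dots,m\}$ and $(u,v]=\{u+1,\dots,v\}$. -}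

module Defs where

open import Data.Bool using (Bool; true; false; _∧_; not; if_then_else_)
open import Data.Nat using (ℕ; zero; suc; _+_; _*_; _∸_; _≤ᵇ_; _<ᵇ_)
open import Data.Nat.Combinatorics using (_C_)
open import Data.Fin using (Fin; toℕ)
open import Data.Fin.Properties using (_≟_)
open import Data.Vec using (Vec; []; _∷_; lookup)
open import Data.List using (List; []; _∷_; [_]; map; concatMap; length; filterᵇ; allFin)
open import Data.Bool.ListAction using (and)
open import Relation.Nullary.Decidable using (⌊_⌋)
open import Relation.Binary.PropositionalEquality using (_≡_)

allᵇ : ∀ {A : Set} → (A → Bool) → List A → Bool
allᵇ p xs = and (map p xs)

_⇔ᵇ_ : Bool → Bool → Bool
true  ⇔ᵇ b = b
false ⇔ᵇ b = not b

-- A permutation σ of {0,…,n-1} is represented by the vector (σ 0, …, σ (n-1)).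
-- Its permutation matrix has P(i,j) = 1 iff lookup σ i ≡ j  (0-indexed rows/columns;
-- paper row/column r corresponds to index r-1).

allVecs : (k n : ℕ) → List (Vec (Fin n) k)
allVecs zero    n = [ [] ]
allVecs (suc k) n = concatMap (λ i → map (i ∷_) (allVecs k n)) (allFin n)

isPerm : ∀ {n} → Vec (Fin n) n → Bool
isPerm {n} σ = allᵇ (λ i → allᵇ (λ j → not ⌊ lookup σ i ≟ lookup σ j ⌋ Data.Bool.∨ ⌊ i ≟ j ⌋) (allFin n)) (allFin n)
  where import Data.Bool

perms : (n : ℕ) → List (Vec (Fin n) n)
perms n = filterᵇ isPerm (allVecs n n)

IsPerm : ∀ {n} → Vec (Fin n) n → Set
IsPerm σ = isPerm σ ≡ true

count : ∀ {A : Set} → (A → Bool) → List A → ℕ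
count p xs = length (filterᵇ p xs)

-- Membership of a 0-indexed position r in the 1-indexed interval (a,b] = {a+1,…,b},
-- i.e.  a ≤ r < b.   [a] = (0,a].
inIv : ℕ → ℕ → ∀ {n} → Fin n → Bool
inIv a b r = (a ≤ᵇ toℕ r) ∧ (toℕ r <ᵇ b)

ones : ∀ {n} → Vec (Fin n) n → (a b c d : ℕ) → ℕ
ones {n} σ a b c d = count (λ i → inIv a b i ∧ inIv c d (lookup σ i)) (allFin n)

inL : (x₁ x₂ y₁ y₂ : ℕ) → ∀ {n} → Fin n → Fin n → Bool
inL x₁ x₂ y₁ y₂ i j = inIv 0 x₂ i ∧ inIv 0 y₂ j ∧ not (inIv 0 x₁ i ∧ inIv 0 y₁ j)

agreeL : (x₁ x₂ y₁ y₂ : ℕ) → ∀ {n} → Vec (Fin n) n → Vec (Fin n) n → Bool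
agreeL x₁ x₂ y₁ y₂ {n} σ τ =
  allᵇ (λ i → allᵇ (λ j → not (inL x₁ x₂ y₁ y₂ i j)
                         Data.Bool.∨ (⌊ lookup σ i ≟ j ⌋ ⇔ᵇ ⌊ lookup τ i ≟ j ⌋))
                 (allFin n))
      (allFin n)
  where import Data.Bool

-- HyperGeom(N,B,A): P(X = k) = hgNum N B A k / hgDen N B A, where
-- hgNum N B A k = C(A,k) · C(N-A, B-k)  (0 if k > B),  hgDen N B A = C(N,B).
hgNum : (N B A k : ℕ) → ℕ
hgNum N B A k = if k ≤ᵇ B then (A C k) * ((N ∸ A) C (B ∸ k)) else 0

hgDen : (N B A : ℕ) → ℕ
hgDen N B A = N C B

{-# OPTIONS --safe #-}
module Submission where

-- Condition on σ agreeing with τ on L and cut the matrix into 3 × 3 blocks at rows x₁, x₂ and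
-- columns y₁, y₂; write onesᵣₛ σ for the number of ones of σ in block (r, s), so that X = ones₁₁
-- is the count in [x₁] × [y₁].  The blocks 12, 21, 22 lie in L, hence equal m₁, m₂, m₃, and the
-- row and column sums give A = X + ones₁₃, B = X + ones₃₁ and N = X + ones₁₃ + ones₃₁ + ones₃₃.
-- Let f k count the σ with X = k.  Exchanging the images of a row a < x₁ and a row b ≥ x₂ moves a
-- pair of ones from blocks 13 and 31 to blocks 11 and 33 without touching L, so double counting
-- the triples (σ, a, b) gives f (k + 1) · (k + 1) · ones₃₃ = f k · ones₁₃ · ones₃₁ (the block
-- counts being constant on each fibre of X), i.e.
--   f (k + 1) · (k + 1) (N + k + 1 − A − B) = f k · (A − k) (B − k).
-- The hypergeometric weights C(A, k) C(N − A, B − k) satisfy the same first-order recurrence and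
-- vanish at the same small k, so f is proportional to them; Vandermonde's identity fixes the constant.

open import Data.Bool using (Bool; true; false; _∧_; _∨_; not; T?)
open import Data.Bool.Properties using (T-≡; ∧-comm; ∧-identityʳ; ∧-zeroʳ; ∧-conicalˡ; ∧-conicalʳ; ⇔→≡)
open import Data.Fin using (Fin; toℕ; zero; suc; punchOut)
open import Data.Fin.Permutation.Components using (transpose)
open import Data.Fin.Properties using (toℕ<n; _≟_; suc-injective; any?; punchOut-injective; injective⇒≤)
open import Data.List using (List; []; _∷_; map; upTo; allFin; tabulate)
open import Data.List.Membership.Propositional using (_∈_)
open import Data.List.Membership.Propositional.Properties
  using (∈-allFin; ∈-map⁺; ∈-map⁻; ∈-concat⁺′; ∈-filter⁺; ∈-filter⁻; ∈-upTo⁻)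
open import Data.List.Membership.Propositional.Properties.WithK using (unique∧set⇒bag)
open import Data.List.Properties using (map-applyUpTo; map-tabulate)
open import Data.List.Relation.Binary.BagAndSetEquality using (∼bag⇒↭)
open import Data.List.Relation.Binary.Disjoint.Propositional using (Disjoint)
open import Data.List.Relation.Binary.Permutation.Propositional using (_↭_)
open import Data.List.Relation.Binary.Permutation.Propositional.Properties using (↭-length; filter-↭)
open import Data.List.Relation.Unary.All as All using (All)
open import Data.List.Relation.Unary.All.Properties as AllProp using (all⁺; all⁻)
open import Data.List.Relation.Unary.AllPairs as AllPairs using ([]; _∷_)
import Data.List.Relation.Unary.AllPairs.Properties as AllPairsProp
open import Data.List.Relation.Unary.Any using (here; there)
open import Data.List.Relation.Unary.Unique.Propositional using (Unique)
import Data.List.Relation.Unary.Unique.Propositional.Properties as Unique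
open import Data.Nat using (ℕ; zero; suc; _+_; _*_; _∸_; _≤_; _<_; _≤ᵇ_; _<ᵇ_; _≡ᵇ_; z≤n; s≤s; _<?_; _≤?_; NonZero; >-nonZero)
open import Data.Nat.Combinatorics using (_C_; nCk≡nC[n∸k]; nCn≡1; nC1≡n; k>n⇒nCk≡0; nCk+nC[k+1]≡[n+1]C[k+1])
open import Data.Nat.Properties hiding (_≟_; suc-injective)
import Algebra.Properties.CommutativeSemigroup +-commutativeSemigroup as +
import Algebra.Properties.CommutativeSemigroup *-commutativeSemigroup as *
open import Data.Nat.Tactic.RingSolver using (solve-∀)
open import Data.Product using (_×_; _,_; ∃; proj₁; proj₂)
open import Data.Sum using (_⊎_; inj₁; inj₂)
open import Data.Vec as Vec using (Vec; []; _∷_; lookup)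
import Data.Vec.Properties as Vec
open import Function using (_∘_; _⇔_; mk⇔; Equivalence)
open import Function.Definitions using (Injective)
open import Relation.Binary.PropositionalEquality
open import Relation.Nullary using (¬_; yes; no; contradiction)
open import Relation.Nullary.Decidable using (Dec; ⌊_⌋; dec-true; dec-false)
open import Relation.Nullary.Reflects using (Reflects; ofʸ; ofⁿ; det; invert; _×-reflects_; _→-reflects_; ¬-reflects)

open import Defs

private variable
  I K : Set

𝟙 : Bool → ℕ
𝟙 true  = 1
𝟙 false = 0

∑ : List I → (I → ℕ) → ℕ
∑ []       f = 0
∑ (x ∷ xs) f = f x + ∑ xs f

syntax ∑ xs (λ x → e) = ∑[ x ∈ xs ] e

∑-cong : ∀ (xs : List I) {f g : I → ℕ} → (∀ {x} → x ∈ xs → f x ≡ g x) → ∑ xs f ≡ ∑ xs g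
∑-cong []       _  = refl
∑-cong (x ∷ xs) eq = cong₂ _+_ (eq (here refl)) (∑-cong xs (eq ∘ there))

∑-zero : ∀ (xs : List I) → ∑[ _ ∈ xs ] 0 ≡ 0
∑-zero []       = refl
∑-zero (_ ∷ xs) = ∑-zero xs

∑-distrib-+ : ∀ (xs : List I) (f g : I → ℕ) → ∑[ x ∈ xs ] (f x + g x) ≡ ∑ xs f + ∑ xs g
∑-distrib-+ []       f g = refl
∑-distrib-+ (x ∷ xs) f g =
  trans (cong (f x + g x +_) (∑-distrib-+ xs f g)) (+.interchange (f x) (g x) (∑ xs f) (∑ xs g))

*-distribˡ-∑ : ∀ c (xs : List I) (f : I → ℕ) → c * ∑ xs f ≡ ∑[ x ∈ xs ] (c * f x)
*-distribˡ-∑ c []       f = *-zeroʳ c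
*-distribˡ-∑ c (x ∷ xs) f = trans (*-distribˡ-+ c (f x) (∑ xs f)) (cong (c * f x +_) (*-distribˡ-∑ c xs f))

*-distribʳ-∑ : ∀ c (xs : List I) (f : I → ℕ) → ∑ xs f * c ≡ ∑[ x ∈ xs ] (f x * c)
*-distribʳ-∑ c []       f = refl
*-distribʳ-∑ c (x ∷ xs) f = trans (*-distribʳ-+ c (f x) (∑ xs f)) (cong (f x * c +_) (*-distribʳ-∑ c xs f))

∑-comm : ∀ (xs : List I) (ys : List K) (f : I → K → ℕ) →
         ∑[ x ∈ xs ] ∑[ y ∈ ys ] f x y ≡ ∑[ y ∈ ys ] ∑[ x ∈ xs ] f x y
∑-comm []       ys f = sym (∑-zero ys)
∑-comm (x ∷ xs) ys f =
  trans (cong (∑ ys (f x) +_) (∑-comm xs ys f)) (sym (∑-distrib-+ ys (f x) (λ y → ∑[ x ∈ xs ] f x y)))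

∑-map : ∀ (g : I → K) (xs : List I) (f : K → ℕ) → ∑ (map g xs) f ≡ ∑[ x ∈ xs ] f (g x)
∑-map g []       f = refl
∑-map g (x ∷ xs) f = cong (f (g x) +_) (∑-map g xs f)

∑-upTo-suc : ∀ m (f : ℕ → ℕ) → ∑ (upTo (suc m)) f ≡ f 0 + ∑[ j ∈ upTo m ] f (suc j)
∑-upTo-suc m f = cong (f 0 +_) (trans (cong (λ js → ∑ js f) (sym (map-applyUpTo (λ j → j) suc m))) (∑-map suc (upTo m) f))

𝟙-∧ : ∀ a b → 𝟙 (a ∧ b) ≡ 𝟙 a * 𝟙 b
𝟙-∧ true  b = sym (+-identityʳ (𝟙 b))
𝟙-∧ false b = refl

count≡∑𝟙 : ∀ (p : I → Bool) xs → count p xs ≡ ∑[ x ∈ xs ] 𝟙 (p x)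
count≡∑𝟙 p []       = refl
count≡∑𝟙 p (x ∷ xs) with p x
... | true  = cong suc (count≡∑𝟙 p xs)
... | false = count≡∑𝟙 p xs

count-cong : ∀ {p q : I → Bool} {xs} → (∀ {x} → x ∈ xs → p x ≡ q x) → count p xs ≡ count q xs
count-cong {p = p} {q} {xs} eq =
  trans (count≡∑𝟙 p xs) (trans (∑-cong xs (cong 𝟙 ∘ eq)) (sym (count≡∑𝟙 q xs)))

count-const-false : ∀ (xs : List I) → count (λ _ → false) xs ≡ 0
count-const-false xs = trans (count≡∑𝟙 (λ _ → false) xs) (∑-zero xs)

count-map : ∀ (p : K → Bool) (f : I → K) xs → count p (map f xs) ≡ count (p ∘ f) xs
count-map p f xs = trans (count≡∑𝟙 p (map f xs)) (trans (∑-map f xs (𝟙 ∘ p)) (sym (count≡∑𝟙 (p ∘ f) xs)))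

count-↭ : ∀ (p : I → Bool) {xs ys} → xs ↭ ys → count p xs ≡ count p ys
count-↭ p xs↭ys = ↭-length (filter-↭ _ xs↭ys)

count-+ : ∀ {p q r : I → Bool} xs → (∀ {x} → x ∈ xs → 𝟙 (p x) + 𝟙 (q x) ≡ 𝟙 (r x)) →
          count p xs + count q xs ≡ count r xs
count-+ {p = p} {q} {r} xs pointwise = begin
  count p xs + count q xs                 ≡⟨ cong₂ _+_ (count≡∑𝟙 p xs) (count≡∑𝟙 q xs) ⟩
  ∑ xs (𝟙 ∘ p) + ∑ xs (𝟙 ∘ q)             ≡⟨ sym (∑-distrib-+ xs (𝟙 ∘ p) (𝟙 ∘ q)) ⟩
  ∑[ x ∈ xs ] (𝟙 (p x) + 𝟙 (q x))         ≡⟨ ∑-cong xs pointwise ⟩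
  ∑ xs (𝟙 ∘ r)                            ≡⟨ sym (count≡∑𝟙 r xs) ⟩
  count r xs                              ∎
  where open ≡-Reasoning

𝟙-∧ˡ-+ : ∀ s {p q r} → 𝟙 p + 𝟙 q ≡ 𝟙 r → 𝟙 (s ∧ p) + 𝟙 (s ∧ q) ≡ 𝟙 (s ∧ r)
𝟙-∧ˡ-+ true  eq = eq
𝟙-∧ˡ-+ false eq = refl

𝟙-∧ʳ-+ : ∀ {p q r} s → 𝟙 p + 𝟙 q ≡ 𝟙 r → 𝟙 (p ∧ s) + 𝟙 (q ∧ s) ≡ 𝟙 (r ∧ s)
𝟙-∧ʳ-+ {p} {q} {r} s eq rewrite ∧-comm p s | ∧-comm q s | ∧-comm r s = 𝟙-∧ˡ-+ s eq

∑∑-𝟙-∧ : ∀ (p : I → Bool) (q : K → Bool) xs ys →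
         ∑[ a ∈ xs ] ∑[ b ∈ ys ] 𝟙 (p a ∧ q b) ≡ count p xs * count q ys
∑∑-𝟙-∧ p q xs ys = begin
  ∑[ a ∈ xs ] ∑[ b ∈ ys ] 𝟙 (p a ∧ q b)     ≡⟨ ∑-cong xs (λ {a} _ → ∑-cong ys (λ {b} _ → 𝟙-∧ (p a) (q b))) ⟩
  ∑[ a ∈ xs ] ∑[ b ∈ ys ] (𝟙 (p a) * 𝟙 (q b)) ≡⟨ ∑-cong xs (λ {a} _ → sym (*-distribˡ-∑ (𝟙 (p a)) ys (𝟙 ∘ q))) ⟩
  ∑[ a ∈ xs ] (𝟙 (p a) * ∑ ys (𝟙 ∘ q))       ≡⟨ sym (*-distribʳ-∑ (∑ ys (𝟙 ∘ q)) xs (𝟙 ∘ p)) ⟩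
  ∑ xs (𝟙 ∘ p) * ∑ ys (𝟙 ∘ q)                 ≡⟨ sym (cong₂ _*_ (count≡∑𝟙 p xs) (count≡∑𝟙 q ys)) ⟩
  count p xs * count q ys                     ∎
  where open ≡-Reasoning

∑-𝟙*-∑∑ : ∀ (g : I → Bool) (w : I → K → K → Bool) xs ys →
           ∑[ x ∈ xs ] (𝟙 (g x) * ∑[ a ∈ ys ] ∑[ b ∈ ys ] 𝟙 (w x a b))
           ≡ ∑[ a ∈ ys ] ∑[ b ∈ ys ] count (λ x → g x ∧ w x a b) xs
∑-𝟙*-∑∑ g w xs ys = begin
  ∑[ x ∈ xs ] (𝟙 (g x) * ∑[ a ∈ ys ] ∑[ b ∈ ys ] 𝟙 (w x a b))
    ≡⟨ ∑-cong xs (λ {x} _ → distribute x) ⟩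
  ∑[ x ∈ xs ] ∑[ a ∈ ys ] ∑[ b ∈ ys ] 𝟙 (g x ∧ w x a b)
    ≡⟨ ∑-comm xs ys _ ⟩
  ∑[ a ∈ ys ] ∑[ x ∈ xs ] ∑[ b ∈ ys ] 𝟙 (g x ∧ w x a b)
    ≡⟨ ∑-cong ys (λ {a} _ → ∑-comm xs ys (λ x b → 𝟙 (g x ∧ w x a b))) ⟩
  ∑[ a ∈ ys ] ∑[ b ∈ ys ] ∑[ x ∈ xs ] 𝟙 (g x ∧ w x a b)
    ≡⟨ ∑-cong ys (λ {a} _ → ∑-cong ys (λ {b} _ → sym (count≡∑𝟙 _ xs))) ⟩
  ∑[ a ∈ ys ] ∑[ b ∈ ys ] count (λ x → g x ∧ w x a b) xs
    ∎
  where
  open ≡-Reasoning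
  distribute : ∀ x → 𝟙 (g x) * ∑[ a ∈ ys ] ∑[ b ∈ ys ] 𝟙 (w x a b) ≡ ∑[ a ∈ ys ] ∑[ b ∈ ys ] 𝟙 (g x ∧ w x a b)
  distribute x = trans (*-distribˡ-∑ (𝟙 (g x)) ys _) (∑-cong ys (λ {a} _ →
    trans (*-distribˡ-∑ (𝟙 (g x)) ys _) (∑-cong ys (λ {b} _ → sym (𝟙-∧ (g x) (w x a b))))))

∑-𝟙*-const : ∀ (p : I → Bool) (w : I → ℕ) c xs → (∀ {x} → x ∈ xs → p x ≡ true → w x ≡ c) →
             ∑[ x ∈ xs ] (𝟙 (p x) * w x) ≡ count p xs * c
∑-𝟙*-const p w c xs w≡c = begin
  ∑[ x ∈ xs ] (𝟙 (p x) * w x) ≡⟨ ∑-cong xs weight ⟩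
  ∑[ x ∈ xs ] (𝟙 (p x) * c)   ≡⟨ sym (*-distribʳ-∑ c xs (𝟙 ∘ p)) ⟩
  ∑ xs (𝟙 ∘ p) * c            ≡⟨ cong (_* c) (sym (count≡∑𝟙 p xs)) ⟩
  count p xs * c              ∎
  where
  open ≡-Reasoning
  weight : ∀ {x} → x ∈ xs → 𝟙 (p x) * w x ≡ 𝟙 (p x) * c
  weight {x} x∈xs with p x in px
  ... | true  = cong (1 *_) (w≡c x∈xs px)
  ... | false = refl

∑-upTo-𝟙-≡ᵇ : ∀ {t m} → t < m → ∑[ j ∈ upTo m ] 𝟙 (t ≡ᵇ j) ≡ 1
∑-upTo-𝟙-≡ᵇ {zero}  {suc m} _ = trans (∑-upTo-suc m (𝟙 ∘ (0 ≡ᵇ_))) (cong suc (∑-zero (upTo m)))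
∑-upTo-𝟙-≡ᵇ {suc t} {suc m} (s≤s t<m) = trans (∑-upTo-suc m (𝟙 ∘ (suc t ≡ᵇ_))) (∑-upTo-𝟙-≡ᵇ t<m)

count-fibres : ∀ (p : I → Bool) (h : I → ℕ) m xs → (∀ {x} → x ∈ xs → p x ≡ true → h x < m) →
               count p xs ≡ ∑[ j ∈ upTo m ] count (λ x → p x ∧ (h x ≡ᵇ j)) xs
count-fibres p h m xs h<m = begin
  count p xs                                          ≡⟨ count≡∑𝟙 p xs ⟩
  ∑[ x ∈ xs ] 𝟙 (p x)                                 ≡⟨ ∑-cong xs fibre ⟩
  ∑[ x ∈ xs ] ∑[ j ∈ upTo m ] 𝟙 (p x ∧ (h x ≡ᵇ j))    ≡⟨ ∑-comm xs (upTo m) _ ⟩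
  ∑[ j ∈ upTo m ] ∑[ x ∈ xs ] 𝟙 (p x ∧ (h x ≡ᵇ j))    ≡⟨ ∑-cong (upTo m) (λ {j} _ → sym (count≡∑𝟙 _ xs)) ⟩
  ∑[ j ∈ upTo m ] count (λ x → p x ∧ (h x ≡ᵇ j)) xs   ∎
  where
  open ≡-Reasoning
  fibre : ∀ {x} → x ∈ xs → 𝟙 (p x) ≡ ∑[ j ∈ upTo m ] 𝟙 (p x ∧ (h x ≡ᵇ j))
  fibre {x} x∈xs with p x in px
  ... | true  = sym (∑-upTo-𝟙-≡ᵇ (h<m x∈xs px))
  ... | false = sym (∑-zero (upTo m))

reflects-true⁺ : ∀ {P : Set} {b} → Reflects P b → P → b ≡ true
reflects-true⁺ r p = det r (ofʸ p)

reflects-false⁺ : ∀ {P : Set} {b} → Reflects P b → ¬ P → b ≡ false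
reflects-false⁺ r ¬p = det r (ofⁿ ¬p)

reflects-true⁻ : ∀ {P : Set} {b} → Reflects P b → b ≡ true → P
reflects-true⁻ r refl = invert r

reflects-map : ∀ {P Q : Set} {b} → (P → Q) → (Q → P) → Reflects P b → Reflects Q b
reflects-map f g (ofʸ p)  = ofʸ (f p)
reflects-map f g (ofⁿ ¬p) = ofⁿ (¬p ∘ g)

≡true-reflects : ∀ b → Reflects (b ≡ true) b
≡true-reflects true  = ofʸ refl
≡true-reflects false = ofⁿ (λ ())

⇔ᵇ-reflects : ∀ a b → Reflects (a ≡ b) (a ⇔ᵇ b)
⇔ᵇ-reflects true  true  = ofʸ refl
⇔ᵇ-reflects true  false = ofⁿ (λ ())
⇔ᵇ-reflects false true  = ofⁿ (λ ())
⇔ᵇ-reflects false false = ofʸ refl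

⌊⌋-reflects : ∀ {P : Set} (p? : Dec P) → Reflects P ⌊ p? ⌋
⌊⌋-reflects (yes p) = ofʸ p
⌊⌋-reflects (no ¬p) = ofⁿ ¬p

⌊≟⌋-false : ∀ {n} {i j : Fin n} → i ≢ j → ⌊ i ≟ j ⌋ ≡ false
⌊≟⌋-false {i = i} {j} i≢j = reflects-false⁺ (⌊⌋-reflects (i ≟ j)) i≢j

≤ᵇ-true : ∀ {a t} → a ≤ t → (a ≤ᵇ t) ≡ true
≤ᵇ-true {a} {t} a≤t = reflects-true⁺ (≤ᵇ-reflects-≤ a t) a≤t

≤ᵇ-false : ∀ {a t} → t < a → (a ≤ᵇ t) ≡ false
≤ᵇ-false {a} {t} t<a = reflects-false⁺ (≤ᵇ-reflects-≤ a t) (<⇒≱ t<a)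

<ᵇ-true : ∀ {t b} → t < b → (t <ᵇ b) ≡ true
<ᵇ-true {t} {b} t<b = reflects-true⁺ (<ᵇ-reflects-< t b) t<b

<ᵇ-false : ∀ {t b} → b ≤ t → (t <ᵇ b) ≡ false
<ᵇ-false {t} {b} b≤t = reflects-false⁺ (<ᵇ-reflects-< t b) (≤⇒≯ b≤t)

allᵇ-allFin⁺ : ∀ {n} {p : Fin n → Bool} → (∀ i → p i ≡ true) → allᵇ p (allFin n) ≡ true
allᵇ-allFin⁺ {n} {p} all-p = Equivalence.to T-≡ (all⁻ p {allFin n} (All.tabulate (λ {i} _ → Equivalence.from T-≡ (all-p i))))

allᵇ-allFin⁻ : ∀ {n} {p : Fin n → Bool} → allᵇ p (allFin n) ≡ true → ∀ i → p i ≡ true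
allᵇ-allFin⁻ {n} {p} eq i = Equivalence.to T-≡ (All.lookup (all⁺ p (allFin n) (Equivalence.from T-≡ eq)) (∈-allFin i))

allᵇ-allFin² : ∀ {n} {P : Fin n → Fin n → Set} {p : Fin n → Fin n → Bool} → (∀ i j → Reflects (P i j) (p i j)) →
               allᵇ (λ i → allᵇ (p i) (allFin n)) (allFin n) ≡ true ⇔ (∀ i j → P i j)
allᵇ-allFin² r = mk⇔
  (λ eq i j → reflects-true⁻ (r i j) (allᵇ-allFin⁻ (allᵇ-allFin⁻ eq i) j))
  (λ all-P → allᵇ-allFin⁺ (λ i → allᵇ-allFin⁺ (λ j → reflects-true⁺ (r i j) (all-P i j))))

count-allFin-suc : ∀ {n} (p : Fin (suc n) → Bool) → count p (allFin (suc n)) ≡ 𝟙 (p zero) + count (p ∘ suc) (allFin n)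
count-allFin-suc {n} p = begin
  count p (allFin (suc n))                     ≡⟨ count≡∑𝟙 p (allFin (suc n)) ⟩
  𝟙 (p zero) + ∑ (tabulate suc) (𝟙 ∘ p)       ≡⟨ cong (λ is → 𝟙 (p zero) + ∑ is (𝟙 ∘ p)) (sym (map-tabulate (λ i → i) suc)) ⟩
  𝟙 (p zero) + ∑ (map suc (allFin n)) (𝟙 ∘ p) ≡⟨ cong (𝟙 (p zero) +_) (∑-map suc (allFin n) (𝟙 ∘ p)) ⟩
  𝟙 (p zero) + ∑ (allFin n) (𝟙 ∘ p ∘ suc)     ≡⟨ cong (𝟙 (p zero) +_) (count≡∑𝟙 (p ∘ suc) (allFin n)) ⟨
  𝟙 (p zero) + count (p ∘ suc) (allFin n)      ∎
  where open ≡-Reasoning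

inIv-reflects : ∀ a b {n} (i : Fin n) → Reflects (a ≤ toℕ i × toℕ i < b) (inIv a b i)
inIv-reflects a b i = ≤ᵇ-reflects-≤ a (toℕ i) ×-reflects <ᵇ-reflects-< (toℕ i) b

inIv⁺ : ∀ {a b n} {i : Fin n} → a ≤ toℕ i → toℕ i < b → inIv a b i ≡ true
inIv⁺ {a} {b} {i = i} a≤i i<b = reflects-true⁺ (inIv-reflects a b i) (a≤i , i<b)

inIv⁻ : ∀ {a b n} {i : Fin n} → inIv a b i ≡ true → a ≤ toℕ i × toℕ i < b
inIv⁻ {a} {b} {i = i} = reflects-true⁻ (inIv-reflects a b i)

inIv-below : ∀ {a b n} {i : Fin n} → toℕ i < a → inIv a b i ≡ false
inIv-below {a} {b} {i = i} i<a = reflects-false⁺ (inIv-reflects a b i) (λ (a≤i , _) → <⇒≱ i<a a≤i)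

inIv-above : ∀ {a b n} {i : Fin n} → b ≤ toℕ i → inIv a b i ≡ false
inIv-above {a} {b} {i = i} b≤i = reflects-false⁺ (inIv-reflects a b i) (λ (_ , i<b) → ≤⇒≯ b≤i i<b)

inIv-0-n : ∀ {n} (i : Fin n) → inIv 0 n i ≡ true
inIv-0-n i = inIv⁺ z≤n (toℕ<n i)

𝟙-inIv-+ : ∀ {a b c n} → a ≤ b → b ≤ c → ∀ (i : Fin n) → 𝟙 (inIv a b i) + 𝟙 (inIv b c i) ≡ 𝟙 (inIv a c i)
𝟙-inIv-+ {a} {b} {c} a≤b b≤c i with toℕ i <? b
... | yes i<b rewrite <ᵇ-true i<b | <ᵇ-true (<-≤-trans i<b b≤c) | ≤ᵇ-false i<b = +-identityʳ _
... | no  i≮b rewrite ≤ᵇ-true (≤-trans a≤b (≮⇒≥ i≮b)) | ≤ᵇ-true (≮⇒≥ i≮b) | <ᵇ-false (≮⇒≥ i≮b) = refl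

count-inIv-0 : ∀ {b n} → b ≤ n → count (inIv 0 b) (allFin n) ≡ b
count-inIv-0 {b}     {zero}  z≤n = refl
count-inIv-0 {zero}  {suc n} _   = trans (count-allFin-suc {n} (inIv 0 0)) (count-inIv-0 {0} {n} z≤n)
count-inIv-0 {suc b} {suc n} (s≤s b≤n) = trans (count-allFin-suc {n} (inIv 0 (suc b))) (cong suc (count-inIv-0 b≤n))

count-inIv : ∀ {a b n} → a ≤ b → b ≤ n → count (inIv a b) (allFin n) ≡ b ∸ a
count-inIv {a} {b} {n} a≤b b≤n = begin
  count (inIv a b) (allFin n)
    ≡⟨ m+n∸m≡n a _ ⟨
  a + count (inIv a b) (allFin n) ∸ a
    ≡⟨ cong (λ c → c + count (inIv a b) (allFin n) ∸ a) (count-inIv-0 (≤-trans a≤b b≤n)) ⟨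
  count (inIv 0 a) (allFin n) + count (inIv a b) (allFin n) ∸ a
    ≡⟨ cong (_∸ a) (count-+ (allFin n) (λ {i} _ → 𝟙-inIv-+ z≤n a≤b i)) ⟩
  count (inIv 0 b) (allFin n) ∸ a
    ≡⟨ cong (_∸ a) (count-inIv-0 b≤n) ⟩
  b ∸ a
    ∎
  where open ≡-Reasoning

count-≟ : ∀ {n} (a : Fin n) → count (λ i → ⌊ i ≟ a ⌋) (allFin n) ≡ 1
count-≟ {suc n} zero    = trans (count-allFin-suc {n} (λ i → ⌊ i ≟ zero ⌋)) (cong suc (count-const-false (allFin n)))
count-≟ {suc n} (suc a) = trans (count-allFin-suc {n} (λ i → ⌊ i ≟ suc a ⌋)) (trans (count-cong shift) (count-≟ a))
  where
  shift : ∀ {i} → i ∈ allFin n → ⌊ suc i ≟ suc a ⌋ ≡ ⌊ i ≟ a ⌋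
  shift {i} _ = det (⌊⌋-reflects (suc i ≟ suc a)) (reflects-map (cong suc) suc-injective (⌊⌋-reflects (i ≟ a)))

count-bump : ∀ {n} {p q : Fin n → Bool} a → q a ≡ true → p a ≡ false → (∀ {i} → i ≢ a → q i ≡ p i) →
             count q (allFin n) ≡ suc (count p (allFin n))
count-bump {n} {p} {q} a qa pa elsewhere = begin
  count q (allFin n)                                          ≡⟨ count-+ (allFin n) (λ {i} _ → pointwise i) ⟨
  count p (allFin n) + count (λ i → ⌊ i ≟ a ⌋) (allFin n)    ≡⟨ cong (count p (allFin n) +_) (count-≟ a) ⟩
  count p (allFin n) + 1                                      ≡⟨ +-comm (count p (allFin n)) 1 ⟩
  suc (count p (allFin n))                                    ∎
  where
  open ≡-Reasoning
  pointwise : ∀ i → 𝟙 (p i) + 𝟙 ⌊ i ≟ a ⌋ ≡ 𝟙 (q i)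
  pointwise i with i ≟ a
  ... | yes refl rewrite qa | pa = refl
  ... | no  i≢a = trans (+-identityʳ (𝟙 (p i))) (cong 𝟙 (sym (elsewhere i≢a)))

IsPerm⇔injective : ∀ {n} (σ : Vec (Fin n) n) → IsPerm σ ⇔ Injective _≡_ _≡_ (lookup σ)
IsPerm⇔injective σ = mk⇔
  (λ isPerm {i} {j} → Equivalence.to (allᵇ-allFin² reflects) isPerm i j)
  (λ inj → Equivalence.from (allᵇ-allFin² reflects) (λ i j → inj))
  where
  reflects : ∀ i j → Reflects (lookup σ i ≡ lookup σ j → i ≡ j) (not ⌊ lookup σ i ≟ lookup σ j ⌋ ∨ ⌊ i ≟ j ⌋)
  reflects i j = ⌊⌋-reflects (lookup σ i ≟ lookup σ j) →-reflects ⌊⌋-reflects (i ≟ j)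

∈-allVecs : ∀ {k n} (v : Vec (Fin n) k) → v ∈ allVecs k n
∈-allVecs []      = here refl
∈-allVecs {suc k} {n} (i ∷ v) =
  ∈-concat⁺′ (∈-map⁺ (i ∷_) (∈-allVecs v)) (∈-map⁺ (λ j → map (j ∷_) (allVecs k n)) (∈-allFin i))

allVecs-unique : ∀ k n → Unique (allVecs k n)
allVecs-unique zero    n = All.[] ∷ []
allVecs-unique (suc k) n = Unique.concat⁺
  (AllProp.map⁺ (All.tabulate (λ _ → Unique.map⁺ (proj₂ ∘ Vec.∷-injective) (allVecs-unique k n))))
  (AllPairsProp.map⁺ (AllPairs.map disjoint (Unique.allFin⁺ n)))
  where
  disjoint : ∀ {i j : Fin n} → i ≢ j → Disjoint (map (i ∷_) (allVecs k n)) (map (j ∷_) (allVecs k n))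
  disjoint i≢j (v∈i , v∈j) with ∈-map⁻ _ v∈i | ∈-map⁻ _ v∈j
  ... | _ , _ , refl | _ , _ , eq = i≢j (proj₁ (Vec.∷-injective eq))

∈-perms⁺ : ∀ {n} {σ : Vec (Fin n) n} → IsPerm σ → σ ∈ perms n
∈-perms⁺ {σ = σ} isPerm = ∈-filter⁺ (T? ∘ Defs.isPerm) (∈-allVecs σ) (Equivalence.from T-≡ isPerm)

∈-perms⁻ : ∀ {n} {σ : Vec (Fin n) n} → σ ∈ perms n → IsPerm σ
∈-perms⁻ {n} σ∈perms = Equivalence.to T-≡ (proj₂ (∈-filter⁻ (T? ∘ isPerm) {xs = allVecs n n} σ∈perms))

perms-unique : ∀ n → Unique (perms n)
perms-unique n = Unique.filter⁺ (T? ∘ isPerm) (allVecs-unique n n)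

map-↭ : ∀ {f : I → I} {xs} → Unique xs → Injective _≡_ _≡_ f →
        (∀ {x} → x ∈ xs → f x ∈ xs) → (∀ {y} → y ∈ xs → y ∈ map f xs) → map f xs ↭ xs
map-↭ {f = f} {xs} unique inj into onto = ∼bag⇒↭ (unique∧set⇒bag (Unique.map⁺ inj unique) unique (mk⇔ into′ onto))
  where
  into′ : ∀ {y} → y ∈ map f xs → y ∈ xs
  into′ y∈ with ∈-map⁻ f y∈
  ... | _ , x∈xs , refl = into x∈xs

-- A missed value y could be punched out, giving an injection Fin (suc n) → Fin n.
injective⇒surjective : ∀ {n} {f : Fin n → Fin n} → Injective _≡_ _≡_ f → ∀ y → ∃ λ x → f x ≡ y
injective⇒surjective {suc n} {f} inj y with any? (λ x → f x ≟ y)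
... | yes hit = hit
... | no miss = contradiction (injective⇒≤ punchOut-inj) (<-irrefl refl)
  where
  punchOut-inj : Injective _≡_ _≡_ (λ x → punchOut {i = y} (λ y≡fx → miss (x , sym y≡fx)))
  punchOut-inj eq = inj (punchOut-injective {i = y} _ _ eq)

count-∘-injective : ∀ {n} {f : Fin n → Fin n} → Injective _≡_ _≡_ f → ∀ (p : Fin n → Bool) →
                    count (p ∘ f) (allFin n) ≡ count p (allFin n)
count-∘-injective {n} {f} inj p = trans (sym (count-map p f (allFin n)))
  (count-↭ p (map-↭ (Unique.allFin⁺ n) inj (λ _ → ∈-allFin _) onto))
  where
  onto : ∀ {y} → y ∈ allFin n → y ∈ map f (allFin n)
  onto {y} _ with injective⇒surjective inj y
  ... | x , refl = ∈-map⁺ f (∈-allFin x)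

count-∘-involution : ∀ {n} (φ : Vec (Fin n) n → Vec (Fin n) n) → (∀ σ → φ (φ σ) ≡ σ) →
                     (∀ {σ} → IsPerm σ → IsPerm (φ σ)) → ∀ p → count (p ∘ φ) (perms n) ≡ count p (perms n)
count-∘-involution {n} φ involutive preserves p = trans (sym (count-map p φ (perms n)))
  (count-↭ p (map-↭ (perms-unique n) injective (∈-perms⁺ ∘ preserves ∘ ∈-perms⁻) onto))
  where
  injective : Injective _≡_ _≡_ φ
  injective {σ} {τ} eq = trans (sym (involutive σ)) (trans (cong φ eq) (involutive τ))
  onto : ∀ {σ} → σ ∈ perms n → σ ∈ map φ (perms n)
  onto {σ} σ∈ = subst (_∈ map φ (perms n)) (involutive σ) (∈-map⁺ φ (∈-perms⁺ (preserves (∈-perms⁻ σ∈))))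

module _ {n} (a b : Fin n) where

  transpose-left : transpose a b a ≡ b
  transpose-left rewrite dec-true (a ≟ a) refl = refl

  transpose-right : transpose a b b ≡ a
  transpose-right with a ≟ b
  ... | yes refl = transpose-left
  ... | no a≢b rewrite dec-false (b ≟ a) (a≢b ∘ sym) | dec-true (b ≟ b) refl = refl

  transpose-other : ∀ {i} → i ≢ a → i ≢ b → transpose a b i ≡ i
  transpose-other {i} i≢a i≢b rewrite dec-false (i ≟ a) i≢a | dec-false (i ≟ b) i≢b = refl

  transpose-involutive : ∀ i → transpose a b (transpose a b i) ≡ i
  transpose-involutive i with a ≟ i | b ≟ i
  ... | yes refl | _        = trans (cong (transpose a b) transpose-left) transpose-right
  ... | no _     | yes refl = trans (cong (transpose a b) transpose-right) transpose-left
  ... | no a≢i   | no b≢i   = trans (cong (transpose a b) i↦i) i↦i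
    where
    i↦i : transpose a b i ≡ i
    i↦i = transpose-other (a≢i ∘ sym) (b≢i ∘ sym)

swapRows : ∀ {n} → Vec (Fin n) n → Fin n → Fin n → Vec (Fin n) n
swapRows σ a b = Vec.tabulate (lookup σ ∘ transpose a b)

module _ {n} (σ : Vec (Fin n) n) (a b : Fin n) where

  lookup-swapRows : ∀ i → lookup (swapRows σ a b) i ≡ lookup σ (transpose a b i)
  lookup-swapRows = Vec.lookup∘tabulate (lookup σ ∘ transpose a b)

  swapRows-involutive : swapRows (swapRows σ a b) a b ≡ σ
  swapRows-involutive = trans
    (Vec.tabulate-cong (λ i → trans (lookup-swapRows (transpose a b i)) (cong (lookup σ) (transpose-involutive a b i))))
    (Vec.tabulate∘lookup σ)

  swapRows-IsPerm : IsPerm σ → IsPerm (swapRows σ a b)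
  swapRows-IsPerm isPerm = Equivalence.from (IsPerm⇔injective (swapRows σ a b)) λ {i} {j} eq →
    trans (sym (transpose-involutive a b i)) (trans
      (cong (transpose a b) (Equivalence.to (IsPerm⇔injective σ) isPerm
        (trans (sym (lookup-swapRows i)) (trans eq (lookup-swapRows j)))))
      (transpose-involutive a b j))

-- Ones of a permutation matrix in a rectangle

module _ {n} (σ : Vec (Fin n) n) where

  ones-rows-+ : ∀ {a b e} c d → a ≤ b → b ≤ e → ones σ a b c d + ones σ b e c d ≡ ones σ a e c d
  ones-rows-+ {a} {b} {e} c d a≤b b≤e = count-+ (allFin n) λ {i} _ →
    𝟙-∧ʳ-+ {inIv a b i} {inIv b e i} {inIv a e i} (inIv c d (lookup σ i)) (𝟙-inIv-+ a≤b b≤e i)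

  ones-cols-+ : ∀ a b {c d e} → c ≤ d → d ≤ e → ones σ a b c d + ones σ a b d e ≡ ones σ a b c e
  ones-cols-+ a b c≤d d≤e = count-+ (allFin n) (λ {i} _ → 𝟙-∧ˡ-+ (inIv a b i) (𝟙-inIv-+ c≤d d≤e (lookup σ i)))

  ones-all-cols : ∀ {a b} → a ≤ b → b ≤ n → ones σ a b 0 n ≡ b ∸ a
  ones-all-cols {a} {b} a≤b b≤n = trans (count-cong every-column) (count-inIv a≤b b≤n)
    where
    every-column : ∀ {i} → i ∈ allFin n → (inIv a b i ∧ inIv 0 n (lookup σ i)) ≡ inIv a b i
    every-column {i} _ rewrite inIv-0-n (lookup σ i) = ∧-identityʳ (inIv a b i)

  ones-all-rows : IsPerm σ → ∀ {c d} → c ≤ d → d ≤ n → ones σ 0 n c d ≡ d ∸ c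
  ones-all-rows isPerm {c} {d} c≤d d≤n = begin
    ones σ 0 n c d                          ≡⟨ count-cong every-row ⟩
    count (inIv c d ∘ lookup σ) (allFin n)  ≡⟨ count-∘-injective (Equivalence.to (IsPerm⇔injective σ) isPerm) (inIv c d) ⟩
    count (inIv c d) (allFin n)             ≡⟨ count-inIv c≤d d≤n ⟩
    d ∸ c                                   ∎
    where
    open ≡-Reasoning
    every-row : ∀ {i} → i ∈ allFin n → (inIv 0 n i ∧ inIv c d (lookup σ i)) ≡ inIv c d (lookup σ i)
    every-row {i} _ rewrite inIv-0-n i = refl

  ones-row-sum : ∀ {a b c₁ c₂} → a ≤ b → b ≤ n → c₁ ≤ c₂ → c₂ ≤ n →
                 ones σ a b 0 c₁ + ones σ a b c₁ c₂ + ones σ a b c₂ n ≡ b ∸ a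
  ones-row-sum {a} {b} {c₁} {c₂} a≤b b≤n c₁≤c₂ c₂≤n = begin
    ones σ a b 0 c₁ + ones σ a b c₁ c₂ + ones σ a b c₂ n ≡⟨ cong (_+ ones σ a b c₂ n) (ones-cols-+ a b z≤n c₁≤c₂) ⟩
    ones σ a b 0 c₂ + ones σ a b c₂ n                    ≡⟨ ones-cols-+ a b z≤n c₂≤n ⟩
    ones σ a b 0 n                                       ≡⟨ ones-all-cols a≤b b≤n ⟩
    b ∸ a                                                ∎
    where open ≡-Reasoning

  ones-column-sum : IsPerm σ → ∀ {r₁ r₂ c d} → r₁ ≤ r₂ → r₂ ≤ n → c ≤ d → d ≤ n →
                    ones σ 0 r₁ c d + ones σ r₁ r₂ c d + ones σ r₂ n c d ≡ d ∸ c
  ones-column-sum isPerm {r₁} {r₂} {c} {d} r₁≤r₂ r₂≤n c≤d d≤n = begin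
    ones σ 0 r₁ c d + ones σ r₁ r₂ c d + ones σ r₂ n c d ≡⟨ cong (_+ ones σ r₂ n c d) (ones-rows-+ c d z≤n r₁≤r₂) ⟩
    ones σ 0 r₂ c d + ones σ r₂ n c d                    ≡⟨ ones-rows-+ c d z≤n r₂≤n ⟩
    ones σ 0 n c d                                       ≡⟨ ones-all-rows isPerm c≤d d≤n ⟩
    d ∸ c                                                ∎
    where open ≡-Reasoning

record SameOn {n} (S : Fin n → Fin n → Bool) (σ τ : Vec (Fin n) n) : Set where
  constructor sameOn
  field at : ∀ i j → S i j ≡ true → ⌊ lookup σ i ≟ j ⌋ ≡ ⌊ lookup τ i ≟ j ⌋

module _ {n} {S : Fin n → Fin n → Bool} where

  SameOn-sym : ∀ {σ τ} → SameOn S σ τ → SameOn S τ σ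
  SameOn-sym (sameOn same) = sameOn λ i j s → sym (same i j s)

  SameOn-trans : ∀ {σ τ υ} → SameOn S σ τ → SameOn S τ υ → SameOn S σ υ
  SameOn-trans (sameOn same) (sameOn same′) = sameOn λ i j s → trans (same i j s) (same′ i j s)

  SameOn-lookup : ∀ {σ τ i} → SameOn S σ τ → S i (lookup σ i) ≡ true → lookup σ i ≡ lookup τ i
  SameOn-lookup {σ} {τ} {i} (sameOn same) s = sym (reflects-true⁻ (⌊⌋-reflects (lookup τ i ≟ lookup σ i))
    (trans (sym (same i (lookup σ i) s)) (reflects-true⁺ (⌊⌋-reflects (lookup σ i ≟ lookup σ i)) refl)))

  ones-SameOn : ∀ {σ τ} → SameOn S σ τ → ∀ a b c d →
                (∀ {i j} → a ≤ toℕ i → toℕ i < b → c ≤ toℕ j → toℕ j < d → S i j ≡ true) →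
                ones σ a b c d ≡ ones τ a b c d
  ones-SameOn {σ} {τ} same a b c d inside = count-cong same-column
    where
    inside′ : ∀ {i j} → inIv a b i ≡ true → inIv c d j ≡ true → S i j ≡ true
    inside′ row col = let a≤i , i<b = inIv⁻ {a} {b} row ; c≤j , j<d = inIv⁻ {c} {d} col in inside a≤i i<b c≤j j<d
    same-column : ∀ {i} → i ∈ allFin n → (inIv a b i ∧ inIv c d (lookup σ i)) ≡ (inIv a b i ∧ inIv c d (lookup τ i))
    same-column {i} _ with inIv a b i in row
    ... | false = refl
    ... | true  = ⇔→≡ (mk⇔
      (λ col → subst (λ j → inIv c d j ≡ true) (SameOn-lookup same (inside′ row col)) col)
      (λ col → subst (λ j → inIv c d j ≡ true) (SameOn-lookup (SameOn-sym same) (inside′ row col)) col))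

agreeL⇔SameOn : ∀ x₁ x₂ y₁ y₂ {n} (σ τ : Vec (Fin n) n) → agreeL x₁ x₂ y₁ y₂ σ τ ≡ true ⇔ SameOn (inL x₁ x₂ y₁ y₂) σ τ
agreeL⇔SameOn x₁ x₂ y₁ y₂ σ τ = mk⇔ (sameOn ∘ Equivalence.to pointwise) (Equivalence.from pointwise ∘ SameOn.at)
  where
  pointwise = allᵇ-allFin²
    (λ i j → ≡true-reflects (inL x₁ x₂ y₁ y₂ i j) →-reflects ⇔ᵇ-reflects ⌊ lookup σ i ≟ j ⌋ ⌊ lookup τ i ≟ j ⌋)

[a+b+c]∸b≡a+c : ∀ a b c → a + b + c ∸ b ≡ a + c
[a+b+c]∸b≡a+c a b c = trans (cong (_∸ b) (+.xy∙z≈xz∙y a b c)) (m+n∸n≡m (a + c) b)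

corners-of-3×3 : ∀ a₁₁ a₁₂ a₁₃ a₂₁ a₂₂ a₂₃ a₃₁ a₃₂ a₃₃ →
  (a₁₁ + a₁₂ + a₁₃) + (a₂₁ + a₂₂ + a₂₃) + (a₃₁ + a₃₂ + a₃₃) + a₂₂ ∸ (a₂₁ + a₂₂ + a₂₃) ∸ (a₁₂ + a₂₂ + a₃₂)
  ≡ a₁₁ + a₁₃ + a₃₁ + a₃₃
corners-of-3×3 a₁₁ a₁₂ a₁₃ a₂₁ a₂₂ a₂₃ a₃₁ a₃₂ a₃₃ = begin
  row₁ + row₂ + row₃ + a₂₂ ∸ row₂ ∸ column₂     ≡⟨ cong (λ t → t ∸ row₂ ∸ column₂) (rearrange a₁₁ a₁₂ a₁₃ a₂₁ a₂₂ a₂₃ a₃₁ a₃₂ a₃₃) ⟩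
  corners + column₂ + row₂ ∸ row₂ ∸ column₂     ≡⟨ cong (_∸ column₂) (m+n∸n≡m (corners + column₂) row₂) ⟩
  corners + column₂ ∸ column₂                   ≡⟨ m+n∸n≡m corners column₂ ⟩
  corners                                       ∎
  where
  open ≡-Reasoning
  row₁ row₂ row₃ column₂ corners : ℕ
  row₁    = a₁₁ + a₁₂ + a₁₃
  row₂    = a₂₁ + a₂₂ + a₂₃
  row₃    = a₃₁ + a₃₂ + a₃₃
  column₂ = a₁₂ + a₂₂ + a₃₂
  corners = a₁₁ + a₁₃ + a₃₁ + a₃₃
  rearrange : ∀ a b c d e f g h i → (a + b + c) + (d + e + f) + (g + h + i) + e ≡ (a + c + g + i) + (b + e + h) + (d + e + f)
  rearrange = solve-∀

-- Binomial coefficients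

nC0≡1 : ∀ n → n C 0 ≡ 1
nC0≡1 n = trans (nCk≡nC[n∸k] {n = n} z≤n) (nCn≡1 n)

[n+1]C[k+1]≡nCk+nC[k+1] : ∀ n k → suc n C suc k ≡ n C k + n C suc k
[n+1]C[k+1]≡nCk+nC[k+1] n k = sym (nCk+nC[k+1]≡[n+1]C[k+1] n k)

[nC[k+1]]*[k+1]≡[nCk]*[n∸k] : ∀ n k → (n C suc k) * suc k ≡ (n C k) * (n ∸ k)
[nC[k+1]]*[k+1]≡[nCk]*[n∸k] zero k = begin
  (0 C suc k) * suc k ≡⟨ cong (_* suc k) (k>n⇒nCk≡0 {0} {suc k} (s≤s z≤n)) ⟩
  0                   ≡⟨ sym (*-zeroʳ (0 C k)) ⟩
  (0 C k) * 0         ≡⟨ cong ((0 C k) *_) (sym (0∸n≡0 k)) ⟩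
  (0 C k) * (0 ∸ k)   ∎
  where open ≡-Reasoning
[nC[k+1]]*[k+1]≡[nCk]*[n∸k] (suc n) zero = begin
  (suc n C 1) * 1     ≡⟨ trans (*-identityʳ _) (nC1≡n (suc n)) ⟩
  suc n               ≡⟨ sym (*-identityˡ (suc n)) ⟩
  1 * suc n           ≡⟨ cong (_* suc n) (sym (nC0≡1 (suc n))) ⟩
  (suc n C 0) * suc n ∎
  where open ≡-Reasoning
[nC[k+1]]*[k+1]≡[nCk]*[n∸k] (suc n) (suc k) with k <? n
... | yes k<n = begin
  (suc n C (2 + k)) * (2 + k)                           ≡⟨ cong (_* (2 + k)) ([n+1]C[k+1]≡nCk+nC[k+1] n (suc k)) ⟩
  (n C (1 + k) + n C (2 + k)) * (2 + k)                 ≡⟨ *-distribʳ-+ (2 + k) (n C (1 + k)) _ ⟩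
  (n C (1 + k)) * (2 + k) + (n C (2 + k)) * (2 + k)     ≡⟨ cong ((n C (1 + k)) * (2 + k) +_) ([nC[k+1]]*[k+1]≡[nCk]*[n∸k] n (suc k)) ⟩
  (n C (1 + k)) * (2 + k) + (n C (1 + k)) * (n ∸ suc k) ≡⟨ sym (*-distribˡ-+ (n C (1 + k)) (2 + k) _) ⟩
  (n C (1 + k)) * (2 + k + (n ∸ suc k))                 ≡⟨ cong ((n C (1 + k)) *_) 2+k+[n∸[1+k]]≡1+k+[n∸k] ⟩
  (n C (1 + k)) * (1 + k + (n ∸ k))                     ≡⟨ *-distribˡ-+ (n C (1 + k)) (1 + k) _ ⟩
  (n C (1 + k)) * (1 + k) + (n C (1 + k)) * (n ∸ k)     ≡⟨ cong (_+ (n C (1 + k)) * (n ∸ k)) ([nC[k+1]]*[k+1]≡[nCk]*[n∸k] n k) ⟩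
  (n C k) * (n ∸ k) + (n C (1 + k)) * (n ∸ k)           ≡⟨ sym (*-distribʳ-+ (n ∸ k) (n C k) _) ⟩
  (n C k + n C (1 + k)) * (n ∸ k)                       ≡⟨ cong (_* (n ∸ k)) (nCk+nC[k+1]≡[n+1]C[k+1] n k) ⟩
  (suc n C suc k) * (n ∸ k)                             ∎
  where
  open ≡-Reasoning
  2+k+[n∸[1+k]]≡1+k+[n∸k] : 2 + k + (n ∸ suc k) ≡ 1 + k + (n ∸ k)
  2+k+[n∸[1+k]]≡1+k+[n∸k] = trans (sym (+-suc (suc k) (n ∸ suc k))) (cong (suc k +_) (sym (+-∸-assoc 1 k<n)))
... | no k≮n = begin
  (suc n C (2 + k)) * (2 + k)  ≡⟨ cong (_* (2 + k)) (k>n⇒nCk≡0 (s≤s (s≤s (≮⇒≥ k≮n)))) ⟩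
  0                            ≡⟨ sym (*-zeroʳ (suc n C suc k)) ⟩
  (suc n C suc k) * 0          ≡⟨ cong ((suc n C suc k) *_) (sym (m≤n⇒m∸n≡0 (≮⇒≥ k≮n))) ⟩
  (suc n C suc k) * (n ∸ k)    ∎
  where open ≡-Reasoning

0<nCk : ∀ {n k} → k ≤ n → 0 < n C k
0<nCk {n} {zero} _ = subst (0 <_) (sym (nC0≡1 n)) (s≤s z≤n)
0<nCk {suc n} {suc k} (s≤s k≤n) =
  subst (0 <_) (nCk+nC[k+1]≡[n+1]C[k+1] n k) (<-≤-trans (0<nCk k≤n) (m≤m+n (n C k) (n C suc k)))

vandermonde : ∀ a m B → ∑[ j ∈ upTo (suc B) ] ((a C j) * (m C (B ∸ j))) ≡ (a + m) C B
vandermonde zero m B = begin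
  ∑[ j ∈ upTo (suc B) ] ((0 C j) * (m C (B ∸ j)))                 ≡⟨ ∑-upTo-suc B (λ j → (0 C j) * (m C (B ∸ j))) ⟩
  1 * (m C B) + ∑[ j ∈ upTo B ] ((0 C suc j) * (m C (B ∸ suc j)))
    ≡⟨ cong₂ _+_ (*-identityˡ (m C B)) (∑-cong (upTo B) (λ {j} _ → cong (_* (m C (B ∸ suc j))) (k>n⇒nCk≡0 {0} {suc j} (s≤s z≤n)))) ⟩
  m C B + ∑[ _ ∈ upTo B ] 0                                        ≡⟨ cong (m C B +_) (∑-zero (upTo B)) ⟩
  m C B + 0                                                        ≡⟨ +-identityʳ (m C B) ⟩
  m C B                                                            ∎
  where open ≡-Reasoning
vandermonde (suc a) m zero = trans (cong₂ _*_ (nC0≡1 (suc a)) (nC0≡1 m)) (sym (nC0≡1 (suc a + m)))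
vandermonde (suc a) m (suc B) = begin
  ∑[ j ∈ upTo (2 + B) ] ((suc a C j) * (m C (suc B ∸ j)))
    ≡⟨ ∑-upTo-suc (suc B) (λ j → (suc a C j) * (m C (suc B ∸ j))) ⟩
  (suc a C 0) * (m C suc B) + ∑[ j ∈ upTo (suc B) ] ((suc a C suc j) * (m C (B ∸ j)))
    ≡⟨ cong₂ _+_ (cong (_* (m C suc B)) (nC0≡1 (suc a))) (∑-cong (upTo (suc B)) (λ {j} _ → pascal j)) ⟩
  1 * (m C suc B) + ∑[ j ∈ upTo (suc B) ] ((a C j) * (m C (B ∸ j)) + (a C suc j) * (m C (B ∸ j)))
    ≡⟨ cong (1 * (m C suc B) +_) (∑-distrib-+ (upTo (suc B)) (λ j → (a C j) * (m C (B ∸ j))) (λ j → (a C suc j) * (m C (B ∸ j)))) ⟩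
  1 * (m C suc B) + (∑[ j ∈ upTo (suc B) ] ((a C j) * (m C (B ∸ j))) + ∑[ j ∈ upTo (suc B) ] ((a C suc j) * (m C (B ∸ j))))
    ≡⟨ +.x∙yz≈y∙xz (1 * (m C suc B)) (∑[ j ∈ upTo (suc B) ] ((a C j) * (m C (B ∸ j))))
                                     (∑[ j ∈ upTo (suc B) ] ((a C suc j) * (m C (B ∸ j)))) ⟩
  ∑[ j ∈ upTo (suc B) ] ((a C j) * (m C (B ∸ j))) + (1 * (m C suc B) + ∑[ j ∈ upTo (suc B) ] ((a C suc j) * (m C (B ∸ j))))
    ≡⟨ cong₂ _+_ (vandermonde a m B) shifted ⟩
  (a + m) C B + (a + m) C suc B
    ≡⟨ nCk+nC[k+1]≡[n+1]C[k+1] (a + m) B ⟩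
  (suc a + m) C suc B ∎
  where
  open ≡-Reasoning
  shifted : 1 * (m C suc B) + ∑[ j ∈ upTo (suc B) ] ((a C suc j) * (m C (B ∸ j))) ≡ (a + m) C suc B
  shifted = trans (cong (λ c → c * (m C suc B) + ∑[ j ∈ upTo (suc B) ] ((a C suc j) * (m C (B ∸ j)))) (sym (nC0≡1 a)))
                  (trans (sym (∑-upTo-suc (suc B) (λ j → (a C j) * (m C (suc B ∸ j))))) (vandermonde a m (suc B)))
  pascal : ∀ j → (suc a C suc j) * (m C (B ∸ j)) ≡ (a C j) * (m C (B ∸ j)) + (a C suc j) * (m C (B ∸ j))
  pascal j = trans (cong (_* (m C (B ∸ j))) ([n+1]C[k+1]≡nCk+nC[k+1] a j)) (*-distribʳ-+ (m C (B ∸ j)) (a C j) _)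

-- Hypergeometric weights

recurrence-proportional : ∀ (α β : ℕ → ℕ) k₀ {f g : ℕ → ℕ} → (∀ {k} → k₀ ≤ k → NonZero (α k)) →
  (∀ {k} → k < k₀ → f k ≡ 0 × g k ≡ 0) →
  (∀ k → f (suc k) * α k ≡ f k * β k) → (∀ k → g (suc k) * α k ≡ g k * β k) →
  ∀ k → f k * g k₀ ≡ f k₀ * g k
recurrence-proportional α β k₀ {f} {g} α≢0 vanish f-rec g-rec k with k <? k₀
... | yes k<k₀ = let f≡0 , g≡0 = vanish k<k₀ in
  trans (cong (_* g k₀) f≡0) (sym (trans (cong (f k₀ *_) g≡0) (*-zeroʳ (f k₀))))
... | no  k≮k₀ = subst (λ k → f k * g k₀ ≡ f k₀ * g k) (m∸n+n≡m (≮⇒≥ k≮k₀)) (from-k₀ (k ∸ k₀))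
  where
  from-k₀ : ∀ d → f (d + k₀) * g k₀ ≡ f k₀ * g (d + k₀)
  from-k₀ zero    = refl
  from-k₀ (suc d) = *-cancelʳ-≡ _ _ (α i) {{α≢0 (m≤n+m k₀ d)}} (begin
    f (suc i) * g k₀ * α i   ≡⟨ *.xy∙z≈xz∙y (f (suc i)) (g k₀) (α i) ⟩
    f (suc i) * α i * g k₀   ≡⟨ cong (_* g k₀) (f-rec i) ⟩
    f i * β i * g k₀         ≡⟨ *.xy∙z≈xz∙y (f i) (β i) (g k₀) ⟩
    f i * g k₀ * β i         ≡⟨ cong (_* β i) (from-k₀ d) ⟩
    f k₀ * g i * β i         ≡⟨ *-assoc (f k₀) (g i) (β i) ⟩
    f k₀ * (g i * β i)       ≡⟨ cong (f k₀ *_) (sym (g-rec i)) ⟩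
    f k₀ * (g (suc i) * α i) ≡⟨ sym (*-assoc (f k₀) (g (suc i)) (α i)) ⟩
    f k₀ * g (suc i) * α i   ∎)
    where
    open ≡-Reasoning
    i : ℕ
    i = d + k₀

proportional⇒cross : ∀ {f g : ℕ → ℕ} c d .{{_ : NonZero c}} → (∀ k → f k * c ≡ d * g k) →
                     ∀ j k → f j * g k ≡ f k * g j
proportional⇒cross {f} {g} c d prop j k = *-cancelʳ-≡ _ _ c (begin
  f j * g k * c   ≡⟨ *.xy∙z≈xz∙y (f j) (g k) c ⟩
  f j * c * g k   ≡⟨ cong (_* g k) (prop j) ⟩
  d * g j * g k   ≡⟨ *.xy∙z≈xz∙y d (g j) (g k) ⟩
  d * g k * g j   ≡⟨ cong (_* g j) (sym (prop k)) ⟩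
  f k * c * g j   ≡⟨ *.xy∙z≈xz∙y (f k) c (g j) ⟩
  f k * g j * c   ∎)
  where open ≡-Reasoning

module _ {N B A : ℕ} where

  hgNum-≤ : ∀ {k} → k ≤ B → hgNum N B A k ≡ (A C k) * ((N ∸ A) C (B ∸ k))
  hgNum-≤ k≤B rewrite ≤ᵇ-true k≤B = refl

  hgNum-> : ∀ {k} → B < k → hgNum N B A k ≡ 0
  hgNum-> B<k rewrite ≤ᵇ-false B<k = refl

  module _ (A≤N : A ≤ N) where

    private
      M : ℕ
      M = N ∸ A

      A+M≡N : A + M ≡ N
      A+M≡N = m+[n∸m]≡n A≤N

    hgNum-recurrence : ∀ k → hgNum N B A (suc k) * (suc k * (N + suc k ∸ (A + B))) ≡ hgNum N B A k * ((A ∸ k) * (B ∸ k))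
    hgNum-recurrence k with suc k ≤? B
    ... | no  k+1≰B = begin
      hgNum N B A (suc k) * (suc k * (N + suc k ∸ (A + B))) ≡⟨ cong (_* (suc k * (N + suc k ∸ (A + B)))) (hgNum-> (≰⇒> k+1≰B)) ⟩
      0                               ≡⟨ sym (*-zeroʳ (hgNum N B A k * (A ∸ k))) ⟩
      (hgNum N B A k * (A ∸ k)) * 0   ≡⟨ cong ((hgNum N B A k * (A ∸ k)) *_) (sym (m≤n⇒m∸n≡0 (≤-pred (≰⇒> k+1≰B)))) ⟩
      (hgNum N B A k * (A ∸ k)) * (B ∸ k) ≡⟨ *-assoc (hgNum N B A k) (A ∸ k) (B ∸ k) ⟩
      hgNum N B A k * ((A ∸ k) * (B ∸ k)) ∎
      where open ≡-Reasoning
    ... | yes k+1≤B = begin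
      hgNum N B A (suc k) * (suc k * (N + suc k ∸ (A + B)))
        ≡⟨ cong₂ _*_ (hgNum-≤ k+1≤B) (cong (suc k *_) N+k+1∸[A+B]≡M∸j) ⟩
      ((A C suc k) * (M C j)) * (suc k * (M ∸ j))
        ≡⟨ *.interchange (A C suc k) (M C j) (suc k) (M ∸ j) ⟩
      ((A C suc k) * suc k) * ((M C j) * (M ∸ j))
        ≡⟨ cong₂ _*_ ([nC[k+1]]*[k+1]≡[nCk]*[n∸k] A k) (sym ([nC[k+1]]*[k+1]≡[nCk]*[n∸k] M j)) ⟩
      ((A C k) * (A ∸ k)) * ((M C suc j) * suc j)
        ≡⟨ *.interchange (A C k) (A ∸ k) (M C suc j) (suc j) ⟩
      ((A C k) * (M C suc j)) * ((A ∸ k) * suc j)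
        ≡⟨ cong₂ (λ i l → ((A C k) * (M C i)) * ((A ∸ k) * l)) B∸k≡j+1 B∸k≡j+1 ⟨
      ((A C k) * (M C (B ∸ k))) * ((A ∸ k) * (B ∸ k))
        ≡⟨ cong (_* ((A ∸ k) * (B ∸ k))) (hgNum-≤ (≤-trans (n≤1+n k) k+1≤B)) ⟨
      hgNum N B A k * ((A ∸ k) * (B ∸ k))
        ∎
      where
      open ≡-Reasoning
      j : ℕ
      j = B ∸ suc k
      k+1+j≡B : suc k + j ≡ B
      k+1+j≡B = m+[n∸m]≡n k+1≤B
      B∸k≡j+1 : B ∸ k ≡ suc j
      B∸k≡j+1 = trans (cong (_∸ k) (trans (sym k+1+j≡B) (sym (+-suc k j)))) (m+n∸m≡n k (suc j))
      N+k+1∸[A+B]≡M∸j : N + suc k ∸ (A + B) ≡ M ∸ j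
      N+k+1∸[A+B]≡M∸j = begin
        N + suc k ∸ (A + B)               ≡⟨ cong₂ (λ x y → x + suc k ∸ (A + y)) (sym A+M≡N) (sym k+1+j≡B) ⟩
        A + M + suc k ∸ (A + (suc k + j)) ≡⟨ cong (_∸ (A + (suc k + j))) (+-assoc A M (suc k)) ⟩
        A + (M + suc k) ∸ (A + (suc k + j)) ≡⟨ [m+n]∸[m+o]≡n∸o A (M + suc k) (suc k + j) ⟩
        M + suc k ∸ (suc k + j)           ≡⟨ cong (_∸ (suc k + j)) (+-comm M (suc k)) ⟩
        suc k + M ∸ (suc k + j)           ≡⟨ [m+n]∸[m+o]≡n∸o (suc k) M j ⟩
        M ∸ j                             ∎

    hgNum-below : ∀ {k} → N + k < A + B → hgNum N B A k ≡ 0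
    hgNum-below {k} N+k<A+B with k ≤? B
    ... | no  k≰B = hgNum-> (≰⇒> k≰B)
    ... | yes k≤B = trans (hgNum-≤ k≤B) (trans (cong ((A C k) *_) (k>n⇒nCk≡0 M<B∸k)) (*-zeroʳ (A C k)))
      where
      M+k<A+B : A + (M + k) < A + B
      M+k<A+B = subst (_< A + B) (trans (cong (_+ k) (sym A+M≡N)) (+-assoc A M k)) N+k<A+B
      M<B∸k : M < B ∸ k
      M<B∸k = m+n≤o⇒m≤o∸n (suc M) (+-cancelˡ-< A (M + k) B M+k<A+B)

    private
      -- The least k with A + B ≤ N + k, below which every hypergeometric weight vanishes.
      k₀ : ℕ
      k₀ = B ∸ M

      below-k₀ : ∀ {k} → k < k₀ → N + k < A + B
      below-k₀ {k} k<k₀ = subst (_< A + B) (trans (sym (+-assoc A M k)) (cong (_+ k) A+M≡N))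
        (+-monoʳ-< A (≰⇒> (λ B≤M+k → <⇒≱ k<k₀ (m≤n+o⇒m∸n≤o B M B≤M+k))))

      above-k₀ : ∀ {k} → k₀ ≤ k → A + B < N + suc k
      above-k₀ {k} k₀≤k = subst (A + B <_) (sym (+-suc N k)) (s≤s (subst (A + B ≤_) A+[M+k]≡N+k
        (+-monoʳ-≤ A (≤-trans (m≤n+m∸n B M) (+-monoʳ-≤ M k₀≤k)))))
        where
        A+[M+k]≡N+k : A + (M + k) ≡ N + k
        A+[M+k]≡N+k = trans (sym (+-assoc A M k)) (cong (_+ k) A+M≡N)

      hgNum-k₀≢0 : B ≤ N → NonZero (hgNum N B A k₀)
      hgNum-k₀≢0 B≤N = subst NonZero (sym (hgNum-≤ (m∸n≤m B M)))
        (m*n≢0 (A C k₀) (M C (B ∸ k₀)) {{>-nonZero (0<nCk k₀≤A)}} {{>-nonZero (0<nCk B∸k₀≤M)}})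
        where
        k₀≤A : k₀ ≤ A
        k₀≤A = m≤n+o⇒m∸n≤o B M (subst (B ≤_) (trans (sym A+M≡N) (+-comm A M)) B≤N)
        B∸k₀≤M : B ∸ k₀ ≤ M
        B∸k₀≤M with M ≤? B
        ... | yes M≤B = ≤-reflexive (m∸[m∸n]≡n M≤B)
        ... | no  M≰B = subst (λ d → B ∸ d ≤ M) (sym (m≤n⇒m∸n≡0 (≰⇒≥ M≰B))) (≰⇒≥ M≰B)

    ∑-hgNum : ∑[ j ∈ upTo (suc B) ] hgNum N B A j ≡ hgDen N B A
    ∑-hgNum = begin
      ∑[ j ∈ upTo (suc B) ] hgNum N B A j           ≡⟨ ∑-cong (upTo (suc B)) (λ j∈ → hgNum-≤ (≤-pred (∈-upTo⁻ j∈))) ⟩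
      ∑[ j ∈ upTo (suc B) ] ((A C j) * (M C (B ∸ j))) ≡⟨ vandermonde A M B ⟩
      (A + M) C B                                   ≡⟨ cong (_C B) A+M≡N ⟩
      N C B                                         ∎
      where open ≡-Reasoning

    hypergeometric-weights : B ≤ N → (f : ℕ → ℕ) → (∀ {k} → N + k < A + B → f k ≡ 0) →
      (∀ k → f (suc k) * (suc k * (N + suc k ∸ (A + B))) ≡ f k * ((A ∸ k) * (B ∸ k))) →
      ∀ k → f k * hgDen N B A ≡ (∑[ j ∈ upTo (suc B) ] f j) * hgNum N B A k
    hypergeometric-weights B≤N f f-below f-rec k = begin
      f k * hgDen N B A                          ≡⟨ cong (f k *_) ∑-hgNum ⟨
      f k * ∑[ j ∈ upTo (suc B) ] hgNum N B A j  ≡⟨ *-distribˡ-∑ (f k) (upTo (suc B)) (hgNum N B A) ⟩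
      ∑[ j ∈ upTo (suc B) ] (f k * hgNum N B A j) ≡⟨ ∑-cong (upTo (suc B)) (λ {j} _ → cross j) ⟨
      ∑[ j ∈ upTo (suc B) ] (f j * hgNum N B A k) ≡⟨ *-distribʳ-∑ (hgNum N B A k) (upTo (suc B)) f ⟨
      (∑[ j ∈ upTo (suc B) ] f j) * hgNum N B A k ∎
      where
      open ≡-Reasoning
      α β : ℕ → ℕ
      α k = suc k * (N + suc k ∸ (A + B))
      β k = (A ∸ k) * (B ∸ k)
      α≢0 : ∀ {k} → k₀ ≤ k → NonZero (α k)
      α≢0 {k} k₀≤k = m*n≢0 (suc k) _ {{_}} {{>-nonZero (m<n⇒0<n∸m (above-k₀ k₀≤k))}}
      proportional : ∀ k → f k * hgNum N B A k₀ ≡ f k₀ * hgNum N B A k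
      proportional = recurrence-proportional α β k₀ α≢0
        (λ k<k₀ → f-below (below-k₀ k<k₀) , hgNum-below (below-k₀ k<k₀)) f-rec hgNum-recurrence
      cross : ∀ j → f j * hgNum N B A k ≡ f k * hgNum N B A j
      cross j = proportional⇒cross {f} {hgNum N B A} (hgNum N B A k₀) (f k₀) {{hgNum-k₀≢0 B≤N}} proportional j k

-- Conditioning on the L-shaped region

module Conditioned {n x₁ x₂ y₁ y₂ : ℕ} (x₁≤x₂ : x₁ ≤ x₂) (x₂≤n : x₂ ≤ n) (y₁≤y₂ : y₁ ≤ y₂) (y₂≤n : y₂ ≤ n)
               (τ : Vec (Fin n) n) (τ-perm : IsPerm τ) where

  L : Fin n → Fin n → Bool
  L = inL x₁ x₂ y₁ y₂

  Agrees : Vec (Fin n) n → Bool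
  Agrees σ = agreeL x₁ x₂ y₁ y₂ σ τ

  Agrees⇔SameOn : ∀ σ → Agrees σ ≡ true ⇔ SameOn L σ τ
  Agrees⇔SameOn σ = agreeL⇔SameOn x₁ x₂ y₁ y₂ σ τ

  X ones₁₃ ones₃₁ ones₃₃ : Vec (Fin n) n → ℕ
  X σ       = ones σ 0 x₁ 0 y₁
  ones₁₃ σ  = ones σ 0 x₁ y₂ n
  ones₃₁ σ  = ones σ x₂ n 0 y₁
  ones₃₃ σ  = ones σ x₂ n y₂ n

  m₁ m₂ m₃ N B A : ℕ
  m₁ = ones τ 0 x₁ y₁ y₂
  m₂ = ones τ x₁ x₂ 0 y₁
  m₃ = ones τ x₁ x₂ y₁ y₂
  N  = n + m₃ ∸ (x₂ ∸ x₁) ∸ (y₂ ∸ y₁)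
  B  = y₁ ∸ m₂
  A  = x₁ ∸ m₁

  L-reflects : ∀ i j → Reflects ((0 ≤ toℕ i × toℕ i < x₂) × (0 ≤ toℕ j × toℕ j < y₂) ×
                                  ¬ ((0 ≤ toℕ i × toℕ i < x₁) × (0 ≤ toℕ j × toℕ j < y₁))) (L i j)
  L-reflects i j = inIv-reflects 0 x₂ i ×-reflects inIv-reflects 0 y₂ j ×-reflects
                   ¬-reflects (inIv-reflects 0 x₁ i ×-reflects inIv-reflects 0 y₁ j)

  L⁺ : ∀ {i j} → toℕ i < x₂ → toℕ j < y₂ → x₁ ≤ toℕ i ⊎ y₁ ≤ toℕ j → L i j ≡ true
  L⁺ {i} {j} i<x₂ j<y₂ outside = reflects-true⁺ (L-reflects i j) ((z≤n , i<x₂) , (z≤n , j<y₂) , not-inside outside)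
    where
    not-inside : x₁ ≤ toℕ i ⊎ y₁ ≤ toℕ j → ¬ ((0 ≤ toℕ i × toℕ i < x₁) × (0 ≤ toℕ j × toℕ j < y₁))
    not-inside (inj₁ x₁≤i) ((_ , i<x₁) , _) = <⇒≱ i<x₁ x₁≤i
    not-inside (inj₂ y₁≤j) (_ , (_ , j<y₁)) = <⇒≱ j<y₁ y₁≤j

  L⇒<x₂ : ∀ {i j} → L i j ≡ true → toℕ i < x₂
  L⇒<x₂ {i} {j} l = proj₂ (proj₁ (reflects-true⁻ (L-reflects i j) l))

  L⇒column : ∀ {i j} → L i j ≡ true → toℕ i < x₁ → y₁ ≤ toℕ j × toℕ j < y₂
  L⇒column {i} {j} l i<x₁ with reflects-true⁻ (L-reflects i j) l
  ... | _ , (_ , j<y₂) , not-inside = ≮⇒≥ (λ j<y₁ → not-inside ((z≤n , i<x₁) , (z≤n , j<y₁))) , j<y₂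

  module Blocks (σ : Vec (Fin n) n) (σ-perm : IsPerm σ) (agrees : Agrees σ ≡ true) where

    private
      ones₁₂ ones₂₁ ones₂₂ ones₂₃ ones₃₂ : ℕ
      ones₁₂ = ones σ 0 x₁ y₁ y₂
      ones₂₁ = ones σ x₁ x₂ 0 y₁
      ones₂₂ = ones σ x₁ x₂ y₁ y₂
      ones₂₃ = ones σ x₁ x₂ y₂ n
      ones₃₂ = ones σ x₂ n y₁ y₂

      same : SameOn L σ τ
      same = Equivalence.to (Agrees⇔SameOn σ) agrees

      ones₁₂≡m₁ : ones₁₂ ≡ m₁
      ones₁₂≡m₁ = ones-SameOn same 0 x₁ y₁ y₂ λ _ i<x₁ y₁≤j j<y₂ →
        L⁺ (<-≤-trans i<x₁ x₁≤x₂) j<y₂ (inj₂ y₁≤j)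

      ones₂₁≡m₂ : ones₂₁ ≡ m₂
      ones₂₁≡m₂ = ones-SameOn same x₁ x₂ 0 y₁ λ x₁≤i i<x₂ _ j<y₁ →
        L⁺ i<x₂ (<-≤-trans j<y₁ y₁≤y₂) (inj₁ x₁≤i)

      ones₂₂≡m₃ : ones₂₂ ≡ m₃
      ones₂₂≡m₃ = ones-SameOn same x₁ x₂ y₁ y₂ λ x₁≤i i<x₂ _ j<y₂ →
        L⁺ i<x₂ j<y₂ (inj₁ x₁≤i)

      x₁≤n : x₁ ≤ n
      x₁≤n = ≤-trans x₁≤x₂ x₂≤n

      row₁ : X σ + ones₁₂ + ones₁₃ σ ≡ x₁
      row₁ = ones-row-sum σ z≤n x₁≤n y₁≤y₂ y₂≤n

      row₂ : ones₂₁ + ones₂₂ + ones₂₃ ≡ x₂ ∸ x₁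
      row₂ = ones-row-sum σ x₁≤x₂ x₂≤n y₁≤y₂ y₂≤n

      row₃ : ones₃₁ σ + ones₃₂ + ones₃₃ σ ≡ n ∸ x₂
      row₃ = ones-row-sum σ x₂≤n ≤-refl y₁≤y₂ y₂≤n

      column₁ : X σ + ones₂₁ + ones₃₁ σ ≡ y₁
      column₁ = ones-column-sum σ σ-perm x₁≤x₂ x₂≤n z≤n (≤-trans y₁≤y₂ y₂≤n)

      column₂ : ones₁₂ + ones₂₂ + ones₃₂ ≡ y₂ ∸ y₁
      column₂ = ones-column-sum σ σ-perm x₁≤x₂ x₂≤n y₁≤y₂ y₂≤n

      n≡rows : n ≡ (X σ + ones₁₂ + ones₁₃ σ) + (ones₂₁ + ones₂₂ + ones₂₃) + (ones₃₁ σ + ones₃₂ + ones₃₃ σ)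
      n≡rows = sym (trans (cong₂ (λ r₁ r₂ → r₁ + r₂ + (ones₃₁ σ + ones₃₂ + ones₃₃ σ)) row₁ row₂)
                   (trans (cong (x₁ + (x₂ ∸ x₁) +_) row₃)
                   (trans (cong (_+ (n ∸ x₂)) (m+[n∸m]≡n x₁≤x₂)) (m+[n∸m]≡n x₂≤n))))

    A≡X+ones₁₃ : A ≡ X σ + ones₁₃ σ
    A≡X+ones₁₃ = trans (cong₂ _∸_ (sym row₁) (sym ones₁₂≡m₁)) ([a+b+c]∸b≡a+c (X σ) ones₁₂ (ones₁₃ σ))

    B≡X+ones₃₁ : B ≡ X σ + ones₃₁ σ
    B≡X+ones₃₁ = trans (cong₂ _∸_ (sym column₁) (sym ones₂₁≡m₂)) ([a+b+c]∸b≡a+c (X σ) ones₂₁ (ones₃₁ σ))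

    N≡corners : N ≡ X σ + ones₁₃ σ + ones₃₁ σ + ones₃₃ σ
    N≡corners = trans
      (cong₂ _∸_ (cong₂ _∸_ (cong₂ _+_ n≡rows (sym ones₂₂≡m₃)) (sym row₂)) (sym column₂))
      (corners-of-3×3 (X σ) ones₁₂ (ones₁₃ σ) ones₂₁ ones₂₂ ones₂₃ (ones₃₁ σ) ones₃₂ (ones₃₃ σ))

    X≤B : X σ ≤ B
    X≤B = subst (X σ ≤_) (sym B≡X+ones₃₁) (m≤m+n (X σ) (ones₃₁ σ))

    A≤N : A ≤ N
    A≤N = subst₂ _≤_ (sym A≡X+ones₁₃) (sym N≡corners)
      (≤-trans (m≤m+n (X σ + ones₁₃ σ) (ones₃₁ σ)) (m≤m+n _ (ones₃₃ σ)))

    B≤N : B ≤ N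
    B≤N = subst₂ _≤_ (sym B≡X+ones₃₁) (sym N≡corners)
      (≤-trans (+-monoˡ-≤ (ones₃₁ σ) (m≤m+n (X σ) (ones₁₃ σ))) (m≤m+n _ (ones₃₃ σ)))

    N+X≡A+B+ones₃₃ : N + X σ ≡ A + B + ones₃₃ σ
    N+X≡A+B+ones₃₃ rewrite A≡X+ones₁₃ | B≡X+ones₃₁ | N≡corners = rearrange (X σ) (ones₁₃ σ) (ones₃₁ σ) (ones₃₃ σ)
      where
      rearrange : ∀ x a b c → x + a + b + c + x ≡ x + a + (x + b) + c
      rearrange = solve-∀

    A+B≤N+X : A + B ≤ N + X σ
    A+B≤N+X = subst (A + B ≤_) (sym N+X≡A+B+ones₃₃) (m≤m+n (A + B) (ones₃₃ σ))

    ones₃₃≡N+X∸[A+B] : ones₃₃ σ ≡ N + X σ ∸ (A + B)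
    ones₃₃≡N+X∸[A+B] = sym (trans (cong (_∸ (A + B)) N+X≡A+B+ones₃₃) (m+n∸m≡n (A + B) (ones₃₃ σ)))

    ones₁₃≡A∸X : ones₁₃ σ ≡ A ∸ X σ
    ones₁₃≡A∸X = sym (trans (cong (_∸ X σ) A≡X+ones₁₃) (m+n∸m≡n (X σ) (ones₁₃ σ)))

    ones₃₁≡B∸X : ones₃₁ σ ≡ B ∸ X σ
    ones₃₁≡B∸X = sym (trans (cong (_∸ X σ) B≡X+ones₃₁) (m+n∸m≡n (X σ) (ones₃₁ σ)))

  Agrees-τ : Agrees τ ≡ true
  Agrees-τ = Equivalence.from (Agrees⇔SameOn τ) (sameOn λ _ _ _ → refl)

  -- Rows a < x₁ and b ≥ x₂ with their ones in blocks 11 and 33 (diagonal) or 13 and 31 (antidiagonal).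
  diagonal antidiagonal : Vec (Fin n) n → Fin n → Fin n → Bool
  diagonal σ a b     = (inIv 0 x₁ a ∧ inIv 0 y₁ (lookup σ a)) ∧ (inIv x₂ n b ∧ inIv y₂ n (lookup σ b))
  antidiagonal σ a b = (inIv 0 x₁ a ∧ inIv y₂ n (lookup σ a)) ∧ (inIv x₂ n b ∧ inIv 0 y₁ (lookup σ b))

  top-bottom-disjoint : ∀ (i : Fin n) p q → ((inIv 0 x₁ i ∧ p) ∧ (inIv x₂ n i ∧ q)) ≡ false
  top-bottom-disjoint i p q with inIv 0 x₁ i in top
  ... | false = refl
  ... | true rewrite inIv-below {x₂} {n} {i = i} (<-≤-trans (proj₂ (inIv⁻ {0} {x₁} top)) x₁≤x₂) = ∧-zeroʳ p

  diagonal-swapRows : ∀ σ a b → diagonal (swapRows σ a b) a b ≡ antidiagonal σ a b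
  diagonal-swapRows σ a b with a ≟ b
  ... | yes refl = trans (top-bottom-disjoint a (inIv 0 y₁ (lookup σ′ a)) (inIv y₂ n (lookup σ′ a)))
                         (sym (top-bottom-disjoint a (inIv y₂ n (lookup σ a)) (inIv 0 y₁ (lookup σ a))))
    where σ′ = swapRows σ a a
  ... | no  _ rewrite lookup-swapRows σ a b a | lookup-swapRows σ a b b | transpose-left a b | transpose-right a b =
    ∧-swap-inner (inIv 0 x₁ a) (inIv 0 y₁ (lookup σ b)) (inIv x₂ n b) (inIv y₂ n (lookup σ a))
    where
    ∧-swap-inner : ∀ p q r s → (p ∧ q) ∧ (r ∧ s) ≡ (p ∧ s) ∧ (r ∧ q)
    ∧-swap-inner false q r     s = refl
    ∧-swap-inner true  q false s = trans (∧-zeroʳ q) (sym (∧-zeroʳ s))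
    ∧-swap-inner true  q true  s = ∧-comm q s

  module Antidiagonal {σ a b} (anti : antidiagonal σ a b ≡ true) where

    private
      top-row : (inIv 0 x₁ a ∧ inIv y₂ n (lookup σ a)) ≡ true
      top-row = ∧-conicalˡ (inIv 0 x₁ a ∧ inIv y₂ n (lookup σ a)) _ anti
      bottom-row : (inIv x₂ n b ∧ inIv 0 y₁ (lookup σ b)) ≡ true
      bottom-row = ∧-conicalʳ (inIv 0 x₁ a ∧ inIv y₂ n (lookup σ a)) _ anti

    a<x₁ : toℕ a < x₁
    a<x₁ = proj₂ (inIv⁻ {0} {x₁} (∧-conicalˡ (inIv 0 x₁ a) _ top-row))

    y₂≤σa : y₂ ≤ toℕ (lookup σ a)
    y₂≤σa = proj₁ (inIv⁻ {y₂} {n} (∧-conicalʳ (inIv 0 x₁ a) _ top-row))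

    x₂≤b : x₂ ≤ toℕ b
    x₂≤b = proj₁ (inIv⁻ {x₂} {n} (∧-conicalˡ (inIv x₂ n b) _ bottom-row))

    σb<y₁ : toℕ (lookup σ b) < y₁
    σb<y₁ = proj₂ (inIv⁻ {0} {y₁} (∧-conicalʳ (inIv x₂ n b) _ bottom-row))

    σ′ : Vec (Fin n) n
    σ′ = swapRows σ a b

    σ′a≡σb : lookup σ′ a ≡ lookup σ b
    σ′a≡σb = trans (lookup-swapRows σ a b a) (cong (lookup σ) (transpose-left a b))

    σ′i≡σi : ∀ {i} → i ≢ a → i ≢ b → lookup σ′ i ≡ lookup σ i
    σ′i≡σi {i} i≢a i≢b = trans (lookup-swapRows σ a b i) (cong (lookup σ) (transpose-other a b i≢a i≢b))

    b-not-top : inIv 0 x₁ b ≡ false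
    b-not-top = inIv-above {0} {x₁} (≤-trans x₁≤x₂ x₂≤b)

    swapRows-SameOn : SameOn L σ′ σ
    swapRows-SameOn = sameOn same
      where
      same : ∀ i j → L i j ≡ true → ⌊ lookup σ′ i ≟ j ⌋ ≡ ⌊ lookup σ i ≟ j ⌋
      same i j l with a ≟ i | b ≟ i
      ... | yes refl | _ = trans (cong (λ c → ⌊ c ≟ j ⌋) σ′a≡σb)
        (trans (⌊≟⌋-false (λ σb≡j → <⇒≱ σb<y₁ (subst (λ c → y₁ ≤ toℕ c) (sym σb≡j) y₁≤j)))
          (sym (⌊≟⌋-false (λ σa≡j → <⇒≱ j<y₂ (subst (λ c → y₂ ≤ toℕ c) σa≡j y₂≤σa)))))
        where
        y₁≤j = proj₁ (L⇒column l a<x₁)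
        j<y₂ = proj₂ (L⇒column l a<x₁)
      ... | no _ | yes refl = contradiction (L⇒<x₂ l) (≤⇒≯ x₂≤b)
      ... | no a≢i | no b≢i = cong (λ c → ⌊ c ≟ j ⌋) (σ′i≡σi (a≢i ∘ sym) (b≢i ∘ sym))

    swapRows-Agrees : Agrees σ′ ≡ Agrees σ
    swapRows-Agrees = ⇔→≡ (mk⇔
      (λ ag′ → Equivalence.from (Agrees⇔SameOn σ) (SameOn-trans (SameOn-sym swapRows-SameOn) (Equivalence.to (Agrees⇔SameOn σ′) ag′)))
      (λ ag → Equivalence.from (Agrees⇔SameOn σ′) (SameOn-trans swapRows-SameOn (Equivalence.to (Agrees⇔SameOn σ) ag))))

    swapRows-X : X σ′ ≡ suc (X σ)
    swapRows-X = count-bump {p = λ i → inIv 0 x₁ i ∧ inIv 0 y₁ (lookup σ i)}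
                            {q = λ i → inIv 0 x₁ i ∧ inIv 0 y₁ (lookup σ′ i)} a
      (trans (cong₂ _∧_ (inIv⁺ z≤n a<x₁) (cong (inIv 0 y₁) σ′a≡σb)) (inIv⁺ z≤n σb<y₁))
      (trans (cong (inIv 0 x₁ a ∧_) (inIv-above {0} {y₁} (≤-trans y₁≤y₂ y₂≤σa))) (∧-zeroʳ (inIv 0 x₁ a)))
      elsewhere
      where
      elsewhere : ∀ {i} → i ≢ a → (inIv 0 x₁ i ∧ inIv 0 y₁ (lookup σ′ i)) ≡ (inIv 0 x₁ i ∧ inIv 0 y₁ (lookup σ i))
      elsewhere {i} i≢a with i ≟ b
      ... | yes refl rewrite b-not-top = refl
      ... | no  i≢b = cong (λ c → inIv 0 x₁ i ∧ inIv 0 y₁ c) (σ′i≡σi i≢a i≢b)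

  fibre : ℕ → Vec (Fin n) n → Bool
  fibre k σ = Agrees σ ∧ (X σ ≡ᵇ k)

  f : ℕ → ℕ
  f k = count (fibre k) (perms n)

  fibre⁻ : ∀ {k σ} → fibre k σ ≡ true → Agrees σ ≡ true × X σ ≡ k
  fibre⁻ {k} {σ} eq = ∧-conicalˡ (Agrees σ) _ eq , ≡ᵇ⇒≡ (X σ) k (Equivalence.from T-≡ (∧-conicalʳ (Agrees σ) _ eq))

  swapRows-fibre : ∀ k σ a b → (fibre (suc k) (swapRows σ a b) ∧ diagonal (swapRows σ a b) a b) ≡ (fibre k σ ∧ antidiagonal σ a b)
  swapRows-fibre k σ a b = trans (cong (fibre (suc k) σ′ ∧_) (diagonal-swapRows σ a b)) (by-cases (antidiagonal σ a b) refl)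
    where
    σ′ = swapRows σ a b
    by-cases : ∀ t → antidiagonal σ a b ≡ t → (fibre (suc k) σ′ ∧ t) ≡ (fibre k σ ∧ t)
    by-cases false _    = trans (∧-zeroʳ (fibre (suc k) σ′)) (sym (∧-zeroʳ (fibre k σ)))
    by-cases true  anti = cong (_∧ true)
      (cong₂ _∧_ (Antidiagonal.swapRows-Agrees {σ} {a} {b} anti) (cong (_≡ᵇ suc k) (Antidiagonal.swapRows-X {σ} {a} {b} anti)))

  count-swapRows : ∀ k a b → count (λ σ → fibre (suc k) σ ∧ diagonal σ a b) (perms n)
                            ≡ count (λ σ → fibre k σ ∧ antidiagonal σ a b) (perms n)
  count-swapRows k a b = trans
    (sym (count-∘-involution (λ σ → swapRows σ a b) (λ σ → swapRows-involutive σ a b) (λ {σ} → swapRows-IsPerm σ a b)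
                             (λ σ → fibre (suc k) σ ∧ diagonal σ a b)))
    (count-cong {xs = perms n} (λ {σ} _ → swapRows-fibre k σ a b))

  fibre-recurrence : ∀ k → f (suc k) * (suc k * (N + suc k ∸ (A + B))) ≡ f k * ((A ∸ k) * (B ∸ k))
  fibre-recurrence k = begin
    f (suc k) * (suc k * (N + suc k ∸ (A + B)))
      ≡⟨ ∑-𝟙*-const (fibre (suc k)) (λ σ → X σ * ones₃₃ σ) _ (perms n) diagonal-weight ⟨
    ∑[ σ ∈ perms n ] (𝟙 (fibre (suc k) σ) * (X σ * ones₃₃ σ))
      ≡⟨ ∑-cong (perms n) (λ {σ} _ → cong (𝟙 (fibre (suc k) σ) *_) (∑∑-𝟙-∧ _ _ (allFin n) (allFin n))) ⟨
    ∑[ σ ∈ perms n ] (𝟙 (fibre (suc k) σ) * ∑[ a ∈ allFin n ] ∑[ b ∈ allFin n ] 𝟙 (diagonal σ a b))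
      ≡⟨ ∑-𝟙*-∑∑ (fibre (suc k)) diagonal (perms n) (allFin n) ⟩
    ∑[ a ∈ allFin n ] ∑[ b ∈ allFin n ] count (λ σ → fibre (suc k) σ ∧ diagonal σ a b) (perms n)
      ≡⟨ ∑-cong (allFin n) (λ {a} _ → ∑-cong (allFin n) (λ {b} _ → count-swapRows k a b)) ⟩
    ∑[ a ∈ allFin n ] ∑[ b ∈ allFin n ] count (λ σ → fibre k σ ∧ antidiagonal σ a b) (perms n)
      ≡⟨ ∑-𝟙*-∑∑ (fibre k) antidiagonal (perms n) (allFin n) ⟨
    ∑[ σ ∈ perms n ] (𝟙 (fibre k σ) * ∑[ a ∈ allFin n ] ∑[ b ∈ allFin n ] 𝟙 (antidiagonal σ a b))
      ≡⟨ ∑-cong (perms n) (λ {σ} _ → cong (𝟙 (fibre k σ) *_) (∑∑-𝟙-∧ _ _ (allFin n) (allFin n))) ⟩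
    ∑[ σ ∈ perms n ] (𝟙 (fibre k σ) * (ones₁₃ σ * ones₃₁ σ))
      ≡⟨ ∑-𝟙*-const (fibre k) (λ σ → ones₁₃ σ * ones₃₁ σ) _ (perms n) antidiagonal-weight ⟩
    f k * ((A ∸ k) * (B ∸ k))
      ∎
    where
    open ≡-Reasoning
    diagonal-weight : ∀ {σ} → σ ∈ perms n → fibre (suc k) σ ≡ true → X σ * ones₃₃ σ ≡ suc k * (N + suc k ∸ (A + B))
    diagonal-weight {σ} σ∈ in-fibre = let agrees , X≡k+1 = fibre⁻ {suc k} {σ} in-fibre in
      trans (cong (X σ *_) (Blocks.ones₃₃≡N+X∸[A+B] σ (∈-perms⁻ σ∈) agrees)) (cong (λ x → x * (N + x ∸ (A + B))) X≡k+1)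
    antidiagonal-weight : ∀ {σ} → σ ∈ perms n → fibre k σ ≡ true → ones₁₃ σ * ones₃₁ σ ≡ (A ∸ k) * (B ∸ k)
    antidiagonal-weight {σ} σ∈ in-fibre = let agrees , X≡k = fibre⁻ {k} {σ} in-fibre in
      trans (cong₂ _*_ (Blocks.ones₁₃≡A∸X σ (∈-perms⁻ σ∈) agrees) (Blocks.ones₃₁≡B∸X σ (∈-perms⁻ σ∈) agrees))
            (cong (λ x → (A ∸ x) * (B ∸ x)) X≡k)

  f-below : ∀ {k} → N + k < A + B → f k ≡ 0
  f-below {k} N+k<A+B = trans (count-cong empty) (count-const-false (perms n))
    where
    empty : ∀ {σ} → σ ∈ perms n → fibre k σ ≡ false
    empty {σ} σ∈ with fibre k σ in in-fibre
    ... | false = refl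
    ... | true = let agrees , X≡k = fibre⁻ {k} {σ} in-fibre in
      contradiction (subst (λ x → A + B ≤ N + x) X≡k (Blocks.A+B≤N+X σ (∈-perms⁻ σ∈) agrees)) (<⇒≱ N+k<A+B)

  count-Agrees : count Agrees (perms n) ≡ ∑[ j ∈ upTo (suc B) ] f j
  count-Agrees = count-fibres Agrees X (suc B) (perms n) (λ {σ} σ∈ agrees → s≤s (Blocks.X≤B σ (∈-perms⁻ σ∈) agrees))

lemma4p9 : (n x₁ x₂ y₁ y₂ : ℕ) → x₁ ≤ x₂ → x₂ ≤ n → y₁ ≤ y₂ → y₂ ≤ n →
    (τ : Vec (Fin n) n) → IsPerm τ → (k : ℕ) →
    let m₁ = ones τ 0 x₁ y₁ y₂
        m₂ = ones τ x₁ x₂ 0 y₁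
        m₃ = ones τ x₁ x₂ y₁ y₂
        N = ((n + m₃) ∸ (x₂ ∸ x₁)) ∸ (y₂ ∸ y₁)
        B = y₁ ∸ m₂
        A = x₁ ∸ m₁
    in count (λ σ → agreeL x₁ x₂ y₁ y₂ σ τ ∧ (ones σ 0 x₁ 0 y₁ ≡ᵇ k)) (perms n) * hgDen N B A
       ≡ count (λ σ → agreeL x₁ x₂ y₁ y₂ σ τ) (perms n) * hgNum N B A k
lemma4p9 n x₁ x₂ y₁ y₂ x₁≤x₂ x₂≤n y₁≤y₂ y₂≤n τ τ-perm k = begin
  f k * hgDen N B A                              ≡⟨ hypergeometric-weights A≤N B≤N f f-below fibre-recurrence k ⟩
  (∑[ j ∈ upTo (suc B) ] f j) * hgNum N B A k    ≡⟨ cong (_* hgNum N B A k) count-Agrees ⟨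
  count Agrees (perms n) * hgNum N B A k         ∎
  where
  open ≡-Reasoning
  open Conditioned x₁≤x₂ x₂≤n y₁≤y₂ y₂≤n τ τ-perm
  open Blocks τ τ-perm Agrees-τ using (A≤N; B≤N)
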